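{- For each $m\in\mathbb{N}_0$, the augmented Plancherel growth process initiated at time $m$, $(\Lambda_m^{(t)})_{t\ge m}$, is a Markov chain with transition probabilities given for any $t\ge m$ and any $\Lambda,\widetilde\Lambda\in\mathbb{Y}^*$ with regular parts $\lambda,\widetilde\lambda$ by \[ \mathbb{P}\left(\Lambda_m^{(t+1)}=\widetilde\Lambda\ \middle|\ \Lambda_m^{(t)}=\Lambda\right)=\begin{cases}\mathbb{P}\left(\lambda^{(t+1)}=\widetilde\lambda\ \middle|\ \lambda^{(t)}=\lambda\right)&\text{if }\Lambda\nearrow\widetilde\Lambda,\\ 0&\text{otherwise},\end{cases} \] where the conditional probability on the right-hand side is the transition probability of the Plancherel growth process $(\lambda^{(n)})_{n\ge 0}$. In particular these transition probabilities do not depend on $m$.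
   Context: Boxes are identified with coordinates $(x,y)\in\mathbb{N}_0^2$ of their lower-left corners (French convention; $x$ = column, $y$ = row, row $0$ at the bottom). Schensted row insertion $\mathcal{T}\leftarrow a$: $a$ is inserted into row $0$ into the leftmost box with entry strictly bigger than $a$; if none, $a$ goes into the leftmost empty box of the row and the procedure stops; otherwise the previous content is bumped into row $1$ and inserted there by the same rule, etc. $P(w_1,\dots,w_\ell)=(\cdots(\emptyset\leftarrow w_1)\cdots)\leftarrow w_\ell$ and $\mathrm{RSK}(w)$ is its shape. Let $\xi_1,\xi_2,\dots$ be i.i.d. uniform on $[0,1]$; the Plancherel growth process is $\lambda^{(n)}=\mathrm{RSK}(\xi_1,\dots,\xi_n)$, $n\ge0$ (a Markov chain on Young diagrams). $\lambda\nearrow\widetilde\lambda$ means $\widetilde\lambda$ is obtained from $\lambda$ by adding a box. An outer corner of $\lambda$ is a box not in $\lambda$ whose addition gives a Young diagram. $\mathbb{Y}^*$ is the set of augmented Young diagrams $(\lambda,\Box)$ ($\lambda$ a Young diagram, called the regular part; $\Box$ an outer corner of $\lambda$, the special box). Augmented Young graph: $(\lambda,\Box)\nearrow(\widetilde\lambda,\widetilde\Box)$ iff $\lambda\nearrow\widetilde\lambda$ and $\widetilde\Box$ is the outer corner of $\widetilde\lambda$ in the row directly above $\Box$ if $\widetilde\lambda/\lambda=\{\Box\}$, while $\widetilde\Box=\Box$ otherwise. For a tableau $\mathcal{T}$ with exactly one entry $\infty$ (a symbol bigger than all other entries), $\operatorname{sh}^*\mathcal{T}=(\text{shape of }\mathcal{T}\text{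 without the box of }\infty,\ \text{position of }\infty)$. The augmented Plancherel growth process initiated at time $m$ is $\Lambda_m^{(t)}=\operatorname{sh}^*P(\xi_1,\dots,\xi_m,\infty,\xi_{m+1},\dots,\xi_t)$ for integers $t\ge m$. -}

module Defs where

open import Data.Nat using (ℕ; zero; suc; _+_; _*_; _∸_; _<_; _≤_; _<ᵇ_)
open import Data.Nat.Properties using (_≟_)
open import Data.Bool using (Bool; true; false; if_then_else_)
open import Data.List using (List; []; _∷_; _++_; length; map; take; drop; upTo; filter; concatMap; reverse)
open import Data.List.Relation.Unary.All using (All)
open import Data.Maybe using (Maybe; just; nothing) renaming (map to mapMaybe)
open import Data.Product using (_×_; _,_; proj₁; proj₂; ∃; Σ)
open import Data.Sum using (_⊎_)
open import Relation.Nullary using (¬_; Dec)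
open import Level using (0ℓ)
open import Relation.Nullary.Decidable using (¬?)
open import Relation.Unary using (Pred; Decidable)
open import Relation.Binary.PropositionalEquality using (_≡_; _≢_)
import Data.List.Properties as LP
import Data.Product.Properties as PP

data Ext : Set where
  fin : ℕ → Ext
  ∞   : Ext

_<ᴱ_ : Ext → Ext → Bool
fin a <ᴱ fin b = a <ᵇ b
fin a <ᴱ ∞     = true
∞     <ᴱ _     = false

Row : Set
Row = List Ext

-- Tableaux: list of rows, row 0 (bottom, French convention) first.
Tableau : Set
Tableau = List Row

insertRow : Ext → Row → Row × Maybe Ext
insertRow a [] = (a ∷ [] , nothing)
insertRow a (b ∷ r) with a <ᴱ b
... | true  = (a ∷ r , just b)
... | false with insertRow a r
...   | (r' , m) = (b ∷ r' , m)

insertT : Tableau → Ext → Tableau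
insertT [] a = (a ∷ []) ∷ []
insertT (r ∷ rs) a with insertRow a r
... | (r' , nothing) = r' ∷ rs
... | (r' , just b)  = r' ∷ insertT rs b

Ptab : List Ext → Tableau
Ptab w = go [] w
  where
  go : Tableau → List Ext → Tableau
  go T []       = T
  go T (a ∷ as) = go (insertT T a) as

-- Young diagrams: lists of row lengths, row 0 first.

Diagram : Set
Diagram = List ℕ

data IsDiagram : Diagram → Set where
  []   : IsDiagram []
  one  : ∀ {a} → 0 < a → IsDiagram (a ∷ [])
  cons : ∀ {a b l} → b ≤ a → IsDiagram (b ∷ l) → IsDiagram (a ∷ b ∷ l)

shape : Tableau → Diagram
shape = map length

-- RSK shape for real-valued (here: natural) words
RSK : List ℕ → Diagram
RSK w = shape (Ptab (map fin w))

-- boxes (x , y) : x = column, y = row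
Box : Set
Box = ℕ × ℕ

rowLen : Diagram → ℕ → ℕ
rowLen []      _       = 0
rowLen (a ∷ _) zero    = a
rowLen (_ ∷ l) (suc y) = rowLen l y

OuterCorner : Diagram → Box → Set
OuterCorner λ' (x , zero)  = rowLen λ' 0 ≡ x
OuterCorner λ' (x , suc y) = rowLen λ' (suc y) ≡ x × x < rowLen λ' y

addBox : Diagram → ℕ → Diagram
addBox []      zero    = 1 ∷ []
addBox []      (suc y) = []  -- never used for outer corners
addBox (a ∷ l) zero    = suc a ∷ l
addBox (a ∷ l) (suc y) = a ∷ addBox l y

_↗_ : Diagram → Diagram → Set
λ' ↗ μ = Σ Box λ b → OuterCorner λ' b × μ ≡ addBox λ' (proj₂ b)

Aug : Set
Aug = Diagram × Box

IsAug : Aug → Set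
IsAug (λ' , □) = IsDiagram λ' × OuterCorner λ' □

_↗*_ : Aug → Aug → Set
(λ' , □) ↗* (μ , □̃) =
  Σ Box λ b → OuterCorner λ' b × μ ≡ addBox λ' (proj₂ b)
    × (b ≡ □ → □̃ ≡ (rowLen μ (suc (proj₂ □)) , suc (proj₂ □)))
    × (b ≢ □ → □̃ ≡ □)

isInf : Ext → Bool
isInf ∞       = true
isInf (fin _) = false

findInRow : Row → Maybe ℕ
findInRow []      = nothing
findInRow (a ∷ r) = if isInf a then just 0 else mapMaybe suc (findInRow r)

findInf : Tableau → Maybe Box
findInf [] = nothing
findInf (r ∷ rs) with findInRow r
... | just x  = just (x , 0)
... | nothing with findInf rs
...   | just (x , y) = just (x , suc y)
...   | nothing      = nothing

removeInf : Row → Row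
removeInf []      = []
removeInf (a ∷ r) = if isInf a then removeInf r else a ∷ removeInf r

shapeStar : Tableau → Aug
shapeStar T with findInf T
... | just b  = (filter (λ n → ¬? (n ≟ 0)) (map (λ r → length (removeInf r)) T) , b)
... | nothing = (shape T , (0 , 0))  -- never happens when ∞ occurs

-- Λ_m^{(k)} computed from the first k letters of w (k ≥ m)
augAt : ℕ → ℕ → List ℕ → Aug
augAt m k w = shapeStar (Ptab (map fin (take m w) ++ ∞ ∷ map fin (drop m (take k w))))

pathOf : ℕ → ℕ → List ℕ → List Aug
pathOf m t w = map (λ i → augAt m (m + i) w) (upTo (suc (t ∸ m)))

-- Permutations of {0,…,n-1} (as words); RSK only depends on the relative
-- order of ξ_1,…,ξ_n, which is a uniformly random permutation.

insertEverywhere : ℕ → List ℕ → List (List ℕ)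
insertEverywhere a []      = (a ∷ []) ∷ []
insertEverywhere a (b ∷ l) = (a ∷ b ∷ l) ∷ map (b ∷_) (insertEverywhere a l)

perms : ℕ → List (List ℕ)
perms zero    = [] ∷ []
perms (suc n) = concatMap (insertEverywhere n) (perms n)

count : {P : Pred (List ℕ) 0ℓ} → Decidable P → List (List ℕ) → ℕ
count P? l = length (filter P? l)

_≟D_ : (a b : Diagram) → Dec (a ≡ b)
_≟D_ = LP.≡-dec _≟_

_≟B_ : (a b : Box) → Dec (a ≡ b)
_≟B_ = PP.≡-dec _≟_ _≟_

_≟A_ : (a b : Aug) → Dec (a ≡ b)
_≟A_ = PP.≡-dec _≟D_ _≟B_

_≟AL_ : (a b : List Aug) → Dec (a ≡ b)
_≟AL_ = LP.≡-dec _≟A_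

{-# OPTIONS --safe #-}
-- Record an RSK insertion by the sequence of rows in which its new boxes appear.
-- Inserting the maximal letter n at each of the n + 1 positions of a permutation of
-- {0, …, n - 1} acts on these recording words as a bijection onto recording words of
-- length n + 1 with a marked corner; the counting identity behind it is DU = UD + I
-- in Young's lattice. By induction, the permutations with a given recording word
-- are counted by the number of standard tableaux of its final shape.
-- The symbol ∞ is a maximal letter too, so Λ_m^(t) can be read off the recording
-- word: ∞ ends a row y, which moves up exactly when a new box lands in row y. Thus
-- Λ_m^(t+1) is a successor of Λ_m^(t) in the augmented Young graph, the one whose
-- regular part is λ^(t+1), and such a successor is unique. So an event made of a
-- condition on the past that fixes the current shape λ and a condition q on the
-- next shape is counted by (number of such pasts) × (weight of the next boxes of λ
-- allowed by q), and the product identity follows.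

module Submission where

open import Defs
open import Data.Nat using (ℕ; zero; suc; _+_; _*_; _∸_; _≤_; _<_; z≤n; s≤s; _<ᵇ_; _≡ᵇ_; pred)
open import Data.Nat.Properties
  using (≡ᵇ⇒≡; <ᵇ⇒<; <⇒≢; 1+n≢n; _≟_; ≤-trans; ≤-refl; ≤-reflexive; ≤-pred; m≤n⇒m⊓n≡m; m≤m+n; m+[n∸m]≡n; n≤1+n;
         +-commutativeSemigroup; +-assoc; +-comm; +-identityʳ; *-comm; *-zeroʳ; *-identityʳ; *-distribʳ-+)
open import Data.Bool using (Bool; true; false; if_then_else_; _∧_; _∨_; not; T)
open import Data.Bool.Properties using (∧-identityʳ; ∧-zeroʳ; ∨-zeroʳ; T-≡)
open import Data.Empty using (⊥-elim)
open import Data.Sum using (_⊎_; inj₁; inj₂)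
open import Relation.Nullary using (¬_; Dec; yes; no; does)
open import Relation.Nullary.Decidable using (T?; ¬?; _×-dec_; dec-false; does-⇔)
open import Data.List using (List; []; _∷_; _++_; length; map; take; drop; upTo; applyUpTo; filter; filterᵇ; concatMap; foldl; _∷ʳ_)
import Data.List.Properties as List
open import Data.List.Relation.Unary.All using (All; []; _∷_)
import Data.List.Relation.Unary.All as All
import Data.List.Relation.Unary.All.Properties as All
open import Data.Maybe using (Maybe; just; nothing; maybe′)
import Data.Maybe.Relation.Unary.All as Maybe
open import Data.Product using (_×_; _,_; proj₁; proj₂)
open import Level using (0ℓ)
open import Relation.Unary using (Pred; Decidable)
open import Function using (_∘_; id; const; Equivalence; mk⇔)
open import Algebra.Properties.CommutativeSemigroup +-commutativeSemigroup using () renaming (interchange to +-interchange)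
open import Relation.Binary.PropositionalEquality
open ≡-Reasoning

infixl 8 _when_
infix  5 ∑ ∑< ∑Where ∑Outer ∑Corner

_when_ : ℕ → Bool → ℕ
x when b = if b then x else 0

∑ : {A : Set} → List A → (A → ℕ) → ℕ
∑ []       f = 0
∑ (x ∷ xs) f = f x + ∑ xs f

syntax ∑ xs (λ x → e) = ∑[ x ∈ xs ] e

∑< : ℕ → (ℕ → ℕ) → ℕ
∑< zero    f = 0
∑< (suc n) f = f 0 + ∑< n (f ∘ suc)

syntax ∑< n (λ i → e) = ∑[ i < n ] e

when-+ : ∀ b x y → (x + y) when b ≡ x when b + y when b
when-+ true  x y = refl
when-+ false x y = refl

when-* : ∀ b c x → (c * x) when b ≡ c * x when b
when-* true  c x = refl
when-* false c x = sym (*-zeroʳ c)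

when-∧ : ∀ a b x → x when b when a ≡ x when (a ∧ b)
when-∧ true  b x = refl
when-∧ false b x = refl

when-∨ : ∀ a b x → (a ∧ b) ≡ false → x when (a ∨ b) ≡ x when a + x when b
when-∨ true  false x _ = sym (+-identityʳ x)
when-∨ false b     x _ = refl

when-cong : ∀ {b x y} → (b ≡ true → x ≡ y) → x when b ≡ y when b
when-cong {true}  e = e refl
when-cong {false} e = refl

1-when-* : ∀ b x → 1 when b * x ≡ x when b
1-when-* true  x = +-identityʳ x
1-when-* false x = refl

module _ {A : Set} where

  ∑-++ : ∀ (xs ys : List A) f → ∑ (xs ++ ys) f ≡ ∑ xs f + ∑ ys f
  ∑-++ []       ys f = refl
  ∑-++ (x ∷ xs) ys f = trans (cong (f x +_) (∑-++ xs ys f)) (sym (+-assoc (f x) _ _))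

  ∑-+ : ∀ (xs : List A) f g → ∑[ x ∈ xs ] (f x + g x) ≡ ∑ xs f + ∑ xs g
  ∑-+ []       f g = refl
  ∑-+ (x ∷ xs) f g = trans (cong (f x + g x +_) (∑-+ xs f g)) (+-interchange (f x) (g x) _ _)

  ∑-*ʳ : ∀ (xs : List A) f c → ∑[ x ∈ xs ] (f x * c) ≡ ∑ xs f * c
  ∑-*ʳ []       f c = refl
  ∑-*ʳ (x ∷ xs) f c = trans (cong (f x * c +_) (∑-*ʳ xs f c)) (sym (*-distribʳ-+ c (f x) _))

  ∑-cong : ∀ (xs : List A) {f g} → (∀ x → f x ≡ g x) → ∑ xs f ≡ ∑ xs g
  ∑-cong []       e = refl
  ∑-cong (x ∷ xs) e = cong₂ _+_ (e x) (∑-cong xs e)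

  ∑-congᴬ : ∀ {P : A → Set} {xs f g} → All P xs → (∀ x → P x → f x ≡ g x) → ∑ xs f ≡ ∑ xs g
  ∑-congᴬ []         e = refl
  ∑-congᴬ (px ∷ pxs) e = cong₂ _+_ (e _ px) (∑-congᴬ pxs e)

∑-map : ∀ {A B : Set} (g : A → B) xs f → ∑ (map g xs) f ≡ ∑[ x ∈ xs ] f (g x)
∑-map g []       f = refl
∑-map g (x ∷ xs) f = cong (f (g x) +_) (∑-map g xs f)

∑-concatMap : ∀ {A B : Set} (g : A → List B) xs f → ∑ (concatMap g xs) f ≡ ∑[ x ∈ xs ] ∑ (g x) f
∑-concatMap g []       f = refl
∑-concatMap g (x ∷ xs) f = trans (∑-++ (g x) _ f) (cong (∑ (g x) f +_) (∑-concatMap g xs f))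

∑-when-factor : ∀ {A : Set} {P : A → Set} {xs} (p : A → Bool) (f : A → ℕ) c → All P xs →
  (∀ x → P x → p x ≡ true → f x ≡ c) → ∑[ x ∈ xs ] f x when p x ≡ (∑[ x ∈ xs ] 1 when p x) * c
∑-when-factor {xs = xs} p f c pxs f≡c =
  trans (∑-congᴬ pxs (λ x px → trans (when-cong (f≡c x px)) (sym (1-when-* (p x) c)))) (∑-*ʳ xs (λ x → 1 when p x) c)

∑-filterᵇ : ∀ {A : Set} (p : A → Bool) xs f → ∑ (filterᵇ p xs) f ≡ ∑[ x ∈ xs ] f x when p x
∑-filterᵇ p []       f = refl
∑-filterᵇ p (x ∷ xs) f with p x
... | true  = cong (f x +_) (∑-filterᵇ p xs f)
... | false = ∑-filterᵇ p xs f

∑-applyUpTo : ∀ (g : ℕ → ℕ) n f → ∑ (applyUpTo g n) f ≡ ∑< n (f ∘ g)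
∑-applyUpTo g zero    f = refl
∑-applyUpTo g (suc n) f = cong (f (g 0) +_) (∑-applyUpTo (g ∘ suc) n f)

∑<-cong : ∀ n {f g} → (∀ i → i < n → f i ≡ g i) → ∑< n f ≡ ∑< n g
∑<-cong zero    e = refl
∑<-cong (suc n) e = cong₂ _+_ (e 0 (s≤s z≤n)) (∑<-cong n (λ i i<n → e (suc i) (s≤s i<n)))

∑<-zero : ∀ n {f} → (∀ i → f i ≡ 0) → ∑< n f ≡ 0
∑<-zero zero    e = refl
∑<-zero (suc n) e = cong₂ _+_ (e 0) (∑<-zero n (e ∘ suc))

∑<-+ : ∀ n f g → ∑[ i < n ] (f i + g i) ≡ ∑< n f + ∑< n g
∑<-+ zero    f g = refl
∑<-+ (suc n) f g = trans (cong (f 0 + g 0 +_) (∑<-+ n (f ∘ suc) (g ∘ suc))) (+-interchange (f 0) (g 0) _ _)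

∑<-*ˡ : ∀ n c f → ∑[ i < n ] (c * f i) ≡ c * ∑< n f
∑<-*ˡ zero    c f = sym (*-zeroʳ c)
∑<-*ˡ (suc n) c f = begin
  c * f 0 + (∑[ i < n ] c * f (suc i))  ≡⟨ cong (c * f 0 +_) (∑<-*ˡ n c (f ∘ suc)) ⟩
  c * f 0 + c * ∑< n (f ∘ suc)          ≡⟨ cong₂ _+_ (*-comm c (f 0)) (*-comm c _) ⟩
  f 0 * c + ∑< n (f ∘ suc) * c          ≡⟨ sym (*-distribʳ-+ c (f 0) _) ⟩
  (f 0 + ∑< n (f ∘ suc)) * c            ≡⟨ *-comm _ c ⟩
  c * (f 0 + ∑< n (f ∘ suc))            ∎

∑<-suc : ∀ n f → ∑< (suc n) f ≡ ∑< n f + f n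
∑<-suc zero    f = +-comm (f 0) 0
∑<-suc (suc n) f = trans (cong (f 0 +_) (∑<-suc n (f ∘ suc))) (sym (+-assoc (f 0) _ _))

∑<-truncate : ∀ {m n} f → m ≤ n → (∀ i → m ≤ i → f i ≡ 0) → ∑< n f ≡ ∑< m f
∑<-truncate {zero} {n} f z≤n e = ∑<-zero n (λ i → e i z≤n)
∑<-truncate {suc m} {suc n} f (s≤s m≤n) e = cong (_ +_) (∑<-truncate (f ∘ suc) m≤n (λ i m≤i → e (suc i) (s≤s m≤i)))

∑<-comm : ∀ m n (f : ℕ → ℕ → ℕ) → ∑[ i < m ] ∑[ j < n ] f i j ≡ ∑[ j < n ] ∑[ i < m ] f i j
∑<-comm zero    n f = sym (∑<-zero n (λ _ → refl))
∑<-comm (suc m) n f = trans (cong (_ +_) (∑<-comm m n (f ∘ suc))) (sym (∑<-+ n (f 0) _))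

when-∑< : ∀ n b f → ∑< n f when b ≡ ∑[ i < n ] (f i when b)
when-∑< n true  f = refl
when-∑< n false f = sym (∑<-zero n (λ _ → refl))

≡ᵇ-refl : ∀ n → (n ≡ᵇ n) ≡ true
≡ᵇ-refl zero    = refl
≡ᵇ-refl (suc n) = ≡ᵇ-refl n

≢⇒≡ᵇ-false : ∀ {m n} → m ≢ n → (m ≡ᵇ n) ≡ false
≢⇒≡ᵇ-false {zero}  {zero}  m≢n = ⊥-elim (m≢n refl)
≢⇒≡ᵇ-false {zero}  {suc n} _   = refl
≢⇒≡ᵇ-false {suc m} {zero}  _   = refl
≢⇒≡ᵇ-false {suc m} {suc n} m≢n = ≢⇒≡ᵇ-false (m≢n ∘ cong suc)

≡ᵇ-cases : ∀ m n → (m ≡ n × (m ≡ᵇ n) ≡ true) ⊎ (m ≢ n × (m ≡ᵇ n) ≡ false)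
≡ᵇ-cases m n with m ≟ n
... | yes refl = inj₁ (refl , ≡ᵇ-refl m)
... | no m≢n   = inj₂ (m≢n , ≢⇒≡ᵇ-false m≢n)

<ᵇ-true⇒< : ∀ m n → (m <ᵇ n) ≡ true → m < n
<ᵇ-true⇒< m n e = <ᵇ⇒< m n (subst T (sym e) _)

<⇒<ᵇ-true : ∀ {m n} → m < n → (m <ᵇ n) ≡ true
<⇒<ᵇ-true {zero}  {suc n} _         = refl
<⇒<ᵇ-true {suc m} {suc n} (s≤s m<n) = <⇒<ᵇ-true m<n

≤⇒≮ᵇ : ∀ {m n} → m ≤ n → (n <ᵇ m) ≡ false
≤⇒≮ᵇ {zero}  {n}     _         = refl
≤⇒≮ᵇ {suc m} {suc n} (s≤s m≤n) = ≤⇒≮ᵇ m≤n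

suc<ᵇ : ∀ a b → (suc a <ᵇ b) ≡ ((a <ᵇ b) ∧ not (b ≡ᵇ suc a))
suc<ᵇ a       zero          = refl
suc<ᵇ zero    (suc zero)    = refl
suc<ᵇ zero    (suc (suc b)) = refl
suc<ᵇ (suc a) (suc b)       = suc<ᵇ a b

<ᵇpred : ∀ a b → (a <ᵇ pred b) ≡ ((a <ᵇ b) ∧ not (b ≡ᵇ suc a))
<ᵇpred a zero    = refl
<ᵇpred a (suc b) = suc<ᵇ a (suc b)

does⇒ : ∀ {P : Set} (P? : Dec P) → does P? ≡ true → P
does⇒ (yes p) _ = p
does⇒ (no _)  ()

take-length-++ : ∀ {A : Set} (xs ys : List A) → take (length xs) (xs ++ ys) ≡ xs
take-length-++ []       ys = refl
take-length-++ (x ∷ xs) ys = cong (x ∷_) (take-length-++ xs ys)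

drop-length-++ : ∀ {A : Set} (xs ys : List A) → drop (length xs) (xs ++ ys) ≡ ys
drop-length-++ []       ys = refl
drop-length-++ (x ∷ xs) ys = drop-length-++ xs ys

take-∷ʳ : ∀ {A : Set} k (xs : List A) x → k ≤ length xs → take k (xs ∷ʳ x) ≡ take k xs
take-∷ʳ zero    xs       x _        = refl
take-∷ʳ (suc k) (y ∷ xs) x (s≤s k≤) = cong (y ∷_) (take-∷ʳ k xs x k≤)

drop-∷ʳ : ∀ {A : Set} k (xs : List A) x → k ≤ length xs → drop k (xs ∷ʳ x) ≡ drop k xs ∷ʳ x
drop-∷ʳ zero    xs       x _        = refl
drop-∷ʳ (suc k) (y ∷ xs) x (s≤s k≤) = drop-∷ʳ k xs x k≤

-- Schensted insertion

mutual
  -- `Ptab` runs a loop that is local to its where-block; unification names it.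
  ptabLoop : List Ext → Tableau → List Ext → Tableau
  ptabLoop = _

  Ptab-unfold : ∀ a l → Ptab (a ∷ l) ≡ ptabLoop (a ∷ l) (insertT [] a) l
  Ptab-unfold a l with a ∷ l | insertT [] a
  ... | _ | _ = refl

ptabLoop≡foldl : ∀ w T l → ptabLoop w T l ≡ foldl insertT T l
ptabLoop≡foldl w T []      = refl
ptabLoop≡foldl w T (a ∷ l) = ptabLoop≡foldl w (insertT T a) l

Ptab≡foldl : ∀ w → Ptab w ≡ foldl insertT [] w
Ptab≡foldl []      = refl
Ptab≡foldl (a ∷ l) = trans (Ptab-unfold a l) (ptabLoop≡foldl (a ∷ l) (insertT [] a) l)

newBoxRow : Tableau → Ext → ℕ
newBoxRow []       a = 0
newBoxRow (r ∷ rs) a with insertRow a r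
... | (_ , nothing) = 0
... | (_ , just b)  = suc (newBoxRow rs b)

-- The recording tableau, as the sequence of rows in which the new boxes appear.
recording : Tableau → List Ext → List ℕ
recording T []      = []
recording T (a ∷ u) = newBoxRow T a ∷ recording (insertT T a) u

recording-++ : ∀ T u v → recording T (u ++ v) ≡ recording T u ++ recording (foldl insertT T u) v
recording-++ T []      v = refl
recording-++ T (a ∷ u) v = cong (newBoxRow T a ∷_) (recording-++ (insertT T a) u v)

length-recording : ∀ T u → length (recording T u) ≡ length u
length-recording T []      = refl
length-recording T (a ∷ u) = cong suc (length-recording (insertT T a) u)

recording-take : ∀ T k u → recording T (take k u) ≡ take k (recording T u)
recording-take T zero    u       = refl
recording-take T (suc k) []      = refl
recording-take T (suc k) (a ∷ u) = cong (newBoxRow T a ∷_) (recording-take (insertT T a) k u)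

insertRow-All : ∀ (P : Ext → Set) {a} r → P a → All P r →
                All P (proj₁ (insertRow a r)) × Maybe.All P (proj₂ (insertRow a r))
insertRow-All P []      pa []         = pa ∷ [] , Maybe.nothing
insertRow-All P {a} (b ∷ r) pa (pb ∷ pr) with a <ᴱ b
... | true  = pa ∷ pr , Maybe.just pb
... | false with insertRow a r | insertRow-All P r pa pr
...   | _ | (pr′ , pm) = pb ∷ pr′ , pm

insertT-All : ∀ (P : Ext → Set) {a} T → P a → All (All P) T → All (All P) (insertT T a)
insertT-All P []       pa []          = (pa ∷ []) ∷ []
insertT-All P {a} (r ∷ rs) pa (pr ∷ prs) with insertRow a r | insertRow-All P r pa pr
... | (_ , nothing) | (pr′ , _)           = pr′ ∷ prs
... | (_ , just b)  | (pr′ , Maybe.just pb) = pr′ ∷ insertT-All P rs pb prs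

foldl-insertT-All : ∀ (P : Ext → Set) {T} u → All P u → All (All P) T → All (All P) (foldl insertT T u)
foldl-insertT-All P []      []         pT = pT
foldl-insertT-All P (a ∷ u) (pa ∷ pu) pT = foldl-insertT-All P u pu (insertT-All P _ pa pT)

length-insertRow : ∀ a r →
  length (proj₁ (insertRow a r)) ≡ maybe′ (const (length r)) (suc (length r)) (proj₂ (insertRow a r))
length-insertRow a []      = refl
length-insertRow a (b ∷ r) with a <ᴱ b
... | true  = refl
... | false with insertRow a r | length-insertRow a r
...   | (_ , nothing) | e = cong suc e
...   | (_ , just _)  | e = cong suc e

shape-insertT : ∀ T a → shape (insertT T a) ≡ addBox (shape T) (newBoxRow T a)
shape-insertT []       a = refl
shape-insertT (r ∷ rs) a with insertRow a r | length-insertRow a r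
... | (_ , nothing) | e = cong (_∷ shape rs) e
... | (_ , just b)  | e = cong₂ _∷_ e (shape-insertT rs b)

shape-foldl : ∀ T u → shape (foldl insertT T u) ≡ foldl addBox (shape T) (recording T u)
shape-foldl T []      = refl
shape-foldl T (a ∷ u) =
  trans (shape-foldl (insertT T a) u) (cong (λ μ → foldl addBox μ (recording (insertT T a) u)) (shape-insertT T a))

NonemptyRows : Tableau → Set
NonemptyRows = All (λ r → 0 < length r)

insertT-NonemptyRows : ∀ T a → NonemptyRows T → NonemptyRows (insertT T a)
insertT-NonemptyRows []       a _ = s≤s z≤n ∷ []
insertT-NonemptyRows (r ∷ rs) a (p ∷ ps) with insertRow a r | length-insertRow a r
... | (_ , nothing) | e = subst (0 <_) (sym e) (s≤s z≤n) ∷ ps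
... | (_ , just b)  | e = subst (0 <_) (sym e) p ∷ insertT-NonemptyRows rs b ps

foldl-insertT-NonemptyRows : ∀ T u → NonemptyRows T → NonemptyRows (foldl insertT T u)
foldl-insertT-NonemptyRows T []      p = p
foldl-insertT-NonemptyRows T (a ∷ u) p =
  foldl-insertT-NonemptyRows (insertT T a) u (insertT-NonemptyRows T a p)

length-insertT : ∀ T a → length T ≤ length (insertT T a)
length-insertT []       a = z≤n
length-insertT (r ∷ rs) a with insertRow a r
... | (_ , nothing) = ≤-refl
... | (_ , just b)  = s≤s (length-insertT rs b)

newBoxRow< : ∀ T a → newBoxRow T a < length (insertT T a)
newBoxRow< []       a = s≤s z≤n
newBoxRow< (r ∷ rs) a with insertRow a r
... | (_ , nothing) = s≤s z≤n
... | (_ , just b)  = s≤s (newBoxRow< rs b)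

-- Insertion in the presence of a maximal letter

-- With a maximal letter at the end of row y, an insertion whose new box would
-- appear in row c behaves as without it, unless c = y: then the maximal letter
-- is bumped, and both it and the new box end up in row y + 1.
boxRow : ℕ → ℕ → ℕ
boxRow y c = if c ≡ᵇ y then suc y else c

maxRowAfter : ℕ → ℕ → ℕ
maxRowAfter y c = if c ≡ᵇ y then suc y else y

shiftRecording : ℕ → List ℕ → List ℕ
shiftRecording y []       = []
shiftRecording y (c ∷ cs) = boxRow y c ∷ shiftRecording (maxRowAfter y c) cs

finalMaxRow : ℕ → List ℕ → ℕ
finalMaxRow y []       = y
finalMaxRow y (c ∷ cs) = finalMaxRow (maxRowAfter y c) cs

boxRow-suc : ∀ y c → boxRow (suc y) (suc c) ≡ suc (boxRow y c)
boxRow-suc y c with c ≡ᵇ y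
... | true  = refl
... | false = refl

maxRowAfter-suc : ∀ y c → maxRowAfter (suc y) (suc c) ≡ suc (maxRowAfter y c)
maxRowAfter-suc y c with c ≡ᵇ y
... | true  = refl
... | false = refl

shiftRecording-∷ʳ : ∀ y cs c → shiftRecording y (cs ∷ʳ c) ≡ shiftRecording y cs ∷ʳ boxRow (finalMaxRow y cs) c
shiftRecording-∷ʳ y []       c = refl
shiftRecording-∷ʳ y (x ∷ cs) c = cong (boxRow y x ∷_) (shiftRecording-∷ʳ (maxRowAfter y x) cs c)

finalMaxRow-∷ʳ : ∀ y cs c → finalMaxRow y (cs ∷ʳ c) ≡ maxRowAfter (finalMaxRow y cs) c
finalMaxRow-∷ʳ y []       c = refl
finalMaxRow-∷ʳ y (x ∷ cs) c = finalMaxRow-∷ʳ (maxRowAfter y x) cs c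

-- The recording word after a maximal letter is inserted at time k, and the row
-- that letter ends in.
withMax : ℕ → List ℕ → List ℕ
withMax k ys = take k ys ++ 0 ∷ shiftRecording 0 (drop k ys)

maxRow : ℕ → List ℕ → ℕ
maxRow k ys = finalMaxRow 0 (drop k ys)

module MaxLetter (z : Ext) where

  Below : Ext → Set
  Below x = (x <ᴱ z ≡ true) × (z <ᴱ x ≡ false)

  withMaxAt : Tableau → ℕ → Tableau
  withMaxAt []       y       = (z ∷ []) ∷ []
  withMaxAt (r ∷ rs) zero    = (r ∷ʳ z) ∷ rs
  withMaxAt (r ∷ rs) (suc y) = r ∷ withMaxAt rs y

  pushMax : Row × Maybe Ext → Row × Maybe Ext
  pushMax (r , just b)  = r ∷ʳ z , just b
  pushMax (r , nothing) = r , just z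

  insertRow-beforeMax : ∀ {a} r → Below a → insertRow a (r ∷ʳ z) ≡ pushMax (insertRow a r)
  insertRow-beforeMax {a} []      (a<z , _) with a <ᴱ z
  insertRow-beforeMax {a} []      (refl , _) | true = refl
  insertRow-beforeMax {a} (b ∷ r) below with a <ᴱ b
  ... | true  = refl
  ... | false rewrite insertRow-beforeMax r below with insertRow a r
  ...   | (_ , just _)  = refl
  ...   | (_ , nothing) = refl

  insertRow-max : ∀ r → All Below r → insertRow z r ≡ (r ∷ʳ z , nothing)
  insertRow-max []      []               = refl
  insertRow-max (b ∷ r) ((_ , z≮b) ∷ bs) with z <ᴱ b
  insertRow-max (b ∷ r) ((_ , refl) ∷ bs) | false rewrite insertRow-max r bs = refl

  insertT-max : ∀ T → All (All Below) T → insertT T z ≡ withMaxAt T 0 × newBoxRow T z ≡ 0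
  insertT-max []       _        = refl , refl
  insertT-max (r ∷ rs) (p ∷ _) rewrite insertRow-max r p = refl , refl

  insertT-withMaxAt : ∀ T y {a} → All (All Below) T → Below a → y ≤ length T →
    insertT (withMaxAt T y) a ≡ withMaxAt (insertT T a) (maxRowAfter y (newBoxRow T a))
    × newBoxRow (withMaxAt T y) a ≡ boxRow y (newBoxRow T a)
  insertT-withMaxAt [] zero {a} _ (a<z , _) _ with a <ᴱ z
  insertT-withMaxAt [] zero {a} _ (refl , _) _ | true = refl , refl
  insertT-withMaxAt (r ∷ rs) zero {a} (p ∷ ps) below _ rewrite insertRow-beforeMax r below
    with insertRow a r | insertRow-All Below r below p
  ... | (_ , nothing) | _ rewrite proj₁ (insertT-max rs ps) | proj₂ (insertT-max rs ps) = refl , refl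
  ... | (_ , just _)  | _ = refl , refl
  insertT-withMaxAt (r ∷ rs) (suc y) {a} (p ∷ ps) below (s≤s y≤)
    with insertRow a r | insertRow-All Below r below p
  ... | (_ , nothing) | _ = refl , refl
  ... | (_ , just b) | (_ , Maybe.just b-below)
    rewrite proj₁ (insertT-withMaxAt rs y ps b-below y≤) | proj₂ (insertT-withMaxAt rs y ps b-below y≤)
          | maxRowAfter-suc y (newBoxRow rs b) | boxRow-suc y (newBoxRow rs b) = refl , refl

  maxRowAfter≤ : ∀ T y a → y ≤ length T → maxRowAfter y (newBoxRow T a) ≤ length (insertT T a)
  maxRowAfter≤ T y a y≤ with newBoxRow T a ≡ᵇ y | ≡ᵇ⇒≡ (newBoxRow T a) y
  ... | true  | eq rewrite sym (eq _) = newBoxRow< T a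
  ... | false | _  = ≤-trans y≤ (length-insertT T a)

  foldl-withMaxAt : ∀ u T y → All (All Below) T → All Below u → y ≤ length T →
    foldl insertT (withMaxAt T y) u ≡ withMaxAt (foldl insertT T u) (finalMaxRow y (recording T u))
    × recording (withMaxAt T y) u ≡ shiftRecording y (recording T u)
  foldl-withMaxAt []      T y _ _ _ = refl , refl
  foldl-withMaxAt (a ∷ u) T y pT (pa ∷ pu) y≤
    rewrite proj₁ (insertT-withMaxAt T y pT pa y≤) | proj₂ (insertT-withMaxAt T y pT pa y≤)
    = proj₁ ih , cong (boxRow y (newBoxRow T a) ∷_) (proj₂ ih)
    where
    ih = foldl-withMaxAt u (insertT T a) _ (insertT-All Below T pa pT) pu (maxRowAfter≤ T y a y≤)

  finalMaxRow≤ : ∀ u T y → y ≤ length T → finalMaxRow y (recording T u) ≤ length (foldl insertT T u)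
  finalMaxRow≤ []      T y y≤ = y≤
  finalMaxRow≤ (a ∷ u) T y y≤ = finalMaxRow≤ u (insertT T a) _ (maxRowAfter≤ T y a y≤)

  insertMaxAt : ∀ u v → All Below u → All Below v →
    let T = foldl insertT [] (u ++ v)
        y = maxRow (length u) (recording [] (u ++ v))
    in foldl insertT [] (u ++ z ∷ v) ≡ withMaxAt T y × y ≤ length T
       × recording [] (u ++ z ∷ v) ≡ withMax (length u) (recording [] (u ++ v))
  insertMaxAt u v pu pv
    rewrite List.foldl-++ insertT [] u (z ∷ v) | List.foldl-++ insertT [] u v
          | recording-++ [] u (z ∷ v) | recording-++ [] u v | sym (length-recording [] u)
          | take-length-++ (recording [] u) (recording (foldl insertT [] u) v)
          | drop-length-++ (recording [] u) (recording (foldl insertT [] u) v)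
          | proj₁ (insertT-max (foldl insertT [] u) (foldl-insertT-All Below u pu []))
          | proj₂ (insertT-max (foldl insertT [] u) (foldl-insertT-All Below u pu []))
    = proj₁ afterMax , finalMaxRow≤ v _ 0 z≤n , cong (λ r → recording [] u ++ 0 ∷ r) (proj₂ afterMax)
    where
    afterMax = foldl-withMaxAt v (foldl insertT [] u) 0 (foldl-insertT-All Below u pu []) pv z≤n

-- Young diagrams

removeBox : Diagram → ℕ → Diagram
removeBox []             s       = []
removeBox (a ∷ l)        (suc s) = a ∷ removeBox l s
removeBox (suc zero ∷ []) zero   = []
removeBox (a ∷ l)        zero    = pred a ∷ l

rowLen-addBox : ∀ μ d j → d ≤ length μ → rowLen (addBox μ d) j ≡ (if j ≡ᵇ d then suc (rowLen μ j) else rowLen μ j)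
rowLen-addBox []      zero    zero    _         = refl
rowLen-addBox []      zero    (suc j) _         = refl
rowLen-addBox (a ∷ l) zero    zero    _         = refl
rowLen-addBox (a ∷ l) zero    (suc j) _         = refl
rowLen-addBox (a ∷ l) (suc d) zero    _         = refl
rowLen-addBox (a ∷ l) (suc d) (suc j) (s≤s d≤) = rowLen-addBox l d j d≤

rowLen-removeBox : ∀ μ s j → rowLen (removeBox μ s) j ≡ (if j ≡ᵇ s then pred (rowLen μ j) else rowLen μ j)
rowLen-removeBox []                  s       j       with j ≡ᵇ s
... | true  = refl
... | false = refl
rowLen-removeBox (zero ∷ l)          zero    zero    = refl
rowLen-removeBox (zero ∷ l)          zero    (suc j) = refl
rowLen-removeBox (suc zero ∷ [])     zero    zero    = refl
rowLen-removeBox (suc zero ∷ [])     zero    (suc j) = refl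
rowLen-removeBox (suc zero ∷ b ∷ l)  zero    zero    = refl
rowLen-removeBox (suc zero ∷ b ∷ l)  zero    (suc j) = refl
rowLen-removeBox (suc (suc a) ∷ l)   zero    zero    = refl
rowLen-removeBox (suc (suc a) ∷ l)   zero    (suc j) = refl
rowLen-removeBox (a ∷ l)             (suc s) zero    = refl
rowLen-removeBox (a ∷ l)             (suc s) (suc j) = rowLen-removeBox l s j

-- Equivalent to `IsDiagram`, in a form suited to reasoning row by row.
Positive : Diagram → Set
Positive = All (0 <_)

Nonincreasing : Diagram → Set
Nonincreasing μ = ∀ j → rowLen μ (suc j) ≤ rowLen μ j

YoungShape : Diagram → Set
YoungShape μ = Positive μ × Nonincreasing μ

rowLen-injective : ∀ {μ ν} → Positive μ → Positive ν → (∀ j → rowLen μ j ≡ rowLen ν j) → μ ≡ ν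
rowLen-injective []       []       _ = refl
rowLen-injective []       (p ∷ _)  e = ⊥-elim (<⇒≢ p (e 0))
rowLen-injective (p ∷ _)  []       e = ⊥-elim (<⇒≢ p (sym (e 0)))
rowLen-injective (_ ∷ pμ) (_ ∷ pν) e = cong₂ _∷_ (e 0) (rowLen-injective pμ pν (e ∘ suc))

rowLen>0⇒< : ∀ μ j → 0 < rowLen μ j → j < length μ
rowLen>0⇒< (a ∷ μ) zero    _ = s≤s z≤n
rowLen>0⇒< (a ∷ μ) (suc j) p = s≤s (rowLen>0⇒< μ j p)

rowLen-beyond : ∀ μ j → length μ ≤ j → rowLen μ j ≡ 0
rowLen-beyond []      j       _          = refl
rowLen-beyond (a ∷ μ) (suc j) (s≤s μ≤j) = rowLen-beyond μ j μ≤j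

isOuter : Diagram → ℕ → Bool
isOuter μ zero    = true
isOuter μ (suc j) = rowLen μ (suc j) <ᵇ rowLen μ j

isCorner : Diagram → ℕ → Bool
isCorner μ s = rowLen μ (suc s) <ᵇ rowLen μ s

-- Adding a box in row d and removing one from row s commute, and do not cancel.
independent : Diagram → ℕ → ℕ → Bool
independent μ d s = not (d ≡ᵇ s) ∧ not ((d ≡ᵇ suc s) ∧ (rowLen μ s ≡ᵇ suc (rowLen μ (suc s))))

isOuter⇒≤length : ∀ μ d → isOuter μ d ≡ true → d ≤ length μ
isOuter⇒≤length μ zero    _ = z≤n
isOuter⇒≤length μ (suc j) o = rowLen>0⇒< μ j (≤-trans (s≤s z≤n) (<ᵇ-true⇒< _ _ o))

isCorner⇒rowLen>0 : ∀ μ s → isCorner μ s ≡ true → 0 < rowLen μ s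
isCorner⇒rowLen>0 μ s e = ≤-trans (s≤s z≤n) (<ᵇ-true⇒< _ _ e)

isOuter-beyond : ∀ μ c → length μ < c → isOuter μ c ≡ false
isOuter-beyond μ (suc j) (s≤s μ≤j) rewrite rowLen-beyond μ j μ≤j = refl

isCorner-beyond : ∀ μ s → length μ ≤ s → isCorner μ s ≡ false
isCorner-beyond μ s μ≤s rewrite rowLen-beyond μ s μ≤s = refl

Positive-addBox : ∀ μ d → Positive μ → d ≤ length μ → Positive (addBox μ d)
Positive-addBox []      zero    _        _        = s≤s z≤n ∷ []
Positive-addBox (a ∷ μ) zero    (_ ∷ ps) _        = s≤s z≤n ∷ ps
Positive-addBox (a ∷ μ) (suc d) (p ∷ ps) (s≤s d≤) = p ∷ Positive-addBox μ d ps d≤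

Positive-removeBox : ∀ μ s → Positive μ → isCorner μ s ≡ true → Positive (removeBox μ s)
Positive-removeBox []                   s       _             _ = []
Positive-removeBox (suc zero ∷ [])      zero    _             _ = []
Positive-removeBox (suc zero ∷ zero ∷ l) zero   (_ ∷ () ∷ _)  _
Positive-removeBox (suc (suc a) ∷ l)    zero    (_ ∷ ps)      _ = s≤s z≤n ∷ ps
Positive-removeBox (a ∷ l)              (suc s) (p ∷ ps)      e = p ∷ Positive-removeBox l s ps e

length-addBox : ∀ μ d → d ≤ length μ → length (addBox μ d) ≤ suc (length μ)
length-addBox []      zero    _        = s≤s z≤n
length-addBox (a ∷ μ) zero    _        = n≤1+n _
length-addBox (a ∷ μ) (suc d) (s≤s d≤) = s≤s (length-addBox μ d d≤)

length-removeBox : ∀ μ s → length (removeBox μ s) ≤ length μ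
length-removeBox []                 s       = z≤n
length-removeBox (zero ∷ l)         zero    = ≤-refl
length-removeBox (suc zero ∷ [])    zero    = z≤n
length-removeBox (suc zero ∷ b ∷ l) zero    = ≤-refl
length-removeBox (suc (suc a) ∷ l)  zero    = ≤-refl
length-removeBox (a ∷ l)            (suc s) = s≤s (length-removeBox l s)

Nonincreasing-addBox : ∀ μ d → Nonincreasing μ → isOuter μ d ≡ true → Nonincreasing (addBox μ d)
Nonincreasing-addBox μ d mono o j
  rewrite rowLen-addBox μ d (suc j) (isOuter⇒≤length μ d o) | rowLen-addBox μ d j (isOuter⇒≤length μ d o)
  with ≡ᵇ-cases (suc j) d | ≡ᵇ-cases j d
... | inj₁ (refl , _)  | inj₁ (j≡1+j , _) = ⊥-elim (1+n≢n (sym j≡1+j))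
... | inj₁ (refl , e₁) | inj₂ (_ , e₂) rewrite e₁ | e₂ = <ᵇ-true⇒< _ _ o
... | inj₂ (_ , e₁)    | inj₁ (refl , e₂) rewrite e₁ | e₂ = ≤-trans (mono j) (n≤1+n _)
... | inj₂ (_ , e₁)    | inj₂ (_ , e₂) rewrite e₁ | e₂ = mono j

YoungShape-addBox : ∀ μ d → YoungShape μ → isOuter μ d ≡ true → YoungShape (addBox μ d)
YoungShape-addBox μ d (pos , mono) o =
  Positive-addBox μ d pos (isOuter⇒≤length μ d o) , Nonincreasing-addBox μ d mono o

removeBox-addBox : ∀ μ d → Positive μ → d ≤ length μ → removeBox (addBox μ d) d ≡ μ
removeBox-addBox []          zero    _        _        = refl
removeBox-addBox (suc a ∷ l) zero    _        _        = refl
removeBox-addBox (a ∷ l)     (suc d) (_ ∷ ps) (s≤s d≤) = cong (a ∷_) (removeBox-addBox l d ps d≤)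

addBox-removeBox : ∀ μ s → Positive μ → isCorner μ s ≡ true → addBox (removeBox μ s) s ≡ μ
addBox-removeBox (suc zero ∷ [])       zero    _            _ = refl
addBox-removeBox (suc zero ∷ zero ∷ l) zero    (_ ∷ () ∷ _) _
addBox-removeBox (suc (suc a) ∷ l)     zero    _            _ = refl
addBox-removeBox (a ∷ l)               (suc s) (_ ∷ ps)     e = cong (a ∷_) (addBox-removeBox l s ps e)

isCorner-addBox : ∀ μ d → YoungShape μ → isOuter μ d ≡ true → ∀ s →
  isCorner (addBox μ d) s ≡ ((s ≡ᵇ d) ∨ (isCorner μ s ∧ independent μ d s))
isCorner-addBox μ d (_ , mono) o s
  rewrite rowLen-addBox μ d (suc s) (isOuter⇒≤length μ d o) | rowLen-addBox μ d s (isOuter⇒≤length μ d o)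
  with ≡ᵇ-cases s d | ≡ᵇ-cases (suc s) d
... | inj₁ (refl , _)   | inj₁ (1+s≡s , _) = ⊥-elim (1+n≢n 1+s≡s)
... | inj₁ (refl , e₁)  | inj₂ (_ , e₂) rewrite e₁ | e₂ = <⇒<ᵇ-true (s≤s (mono s))
... | inj₂ (_ , e₁)     | inj₁ (refl , e₂)
  rewrite e₁ | e₂ | ≢⇒≡ᵇ-false (1+n≢n {s}) | ≡ᵇ-refl s = suc<ᵇ (rowLen μ (suc s)) (rowLen μ s)
... | inj₂ (s≢d , e₁)   | inj₂ (1+s≢d , e₂)
  rewrite e₁ | e₂ | ≢⇒≡ᵇ-false (s≢d ∘ sym) | ≢⇒≡ᵇ-false (1+s≢d ∘ sym) = sym (∧-identityʳ _)

isOuter-removeBox : ∀ μ s → YoungShape μ → isCorner μ s ≡ true → ∀ c →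
  isOuter (removeBox μ s) c ≡ ((c ≡ᵇ s) ∨ (isOuter μ c ∧ independent μ c s))
isOuter-removeBox μ zero    _          _ zero    = refl
isOuter-removeBox μ (suc s) _          _ zero    = refl
isOuter-removeBox μ s       (_ , mono) corner (suc j)
  rewrite rowLen-removeBox μ s (suc j) | rowLen-removeBox μ s j
  with ≡ᵇ-cases (suc j) s | ≡ᵇ-cases j s
... | inj₁ (refl , _)  | inj₁ (j≡1+j , _) = ⊥-elim (1+n≢n (sym j≡1+j))
... | inj₁ (refl , e₁) | inj₂ (_ , e₂) rewrite e₁ | e₂ =
  <⇒<ᵇ-true (pred< (isCorner⇒rowLen>0 μ (suc j) corner) (mono j))
  where
  pred< : ∀ {a b} → 0 < a → a ≤ b → pred a < b
  pred< {suc a} _ a≤b = a≤b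
... | inj₂ (_ , e₁)    | inj₁ (refl , e₂) rewrite e₁ | e₂ | ≡ᵇ-refl j = <ᵇpred (rowLen μ (suc j)) (rowLen μ j)
... | inj₂ (_ , e₁)    | inj₂ (_ , e₂) rewrite e₁ | e₂ = sym (∧-identityʳ _)

independent⇒≢ : ∀ μ d s → independent μ d s ≡ true → (d ≡ᵇ s) ≡ false
independent⇒≢ μ d s ind with d ≡ᵇ s
independent⇒≢ μ d s ()  | true
independent⇒≢ μ d s _   | false = refl

removeBox-addBox-comm : ∀ μ d s → YoungShape μ → isOuter μ d ≡ true → isCorner μ s ≡ true →
  independent μ d s ≡ true → removeBox (addBox μ d) s ≡ addBox (removeBox μ s) d
removeBox-addBox-comm μ d s young@(pos , _) o corner ind =
  rowLen-injective (Positive-removeBox (addBox μ d) s (Positive-addBox μ d pos d≤μ) corner′)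
                   (Positive-addBox (removeBox μ s) d (Positive-removeBox μ s pos corner) d≤μ∖s)
                   sameRows
  where
  d≤μ = isOuter⇒≤length μ d o
  corner′ : isCorner (addBox μ d) s ≡ true
  corner′ rewrite isCorner-addBox μ d young o s | corner | ind = ∨-zeroʳ _
  d≤μ∖s : d ≤ length (removeBox μ s)
  d≤μ∖s = isOuter⇒≤length (removeBox μ s) d outer′
    where
    outer′ : isOuter (removeBox μ s) d ≡ true
    outer′ rewrite isOuter-removeBox μ s young corner d | o | ind = ∨-zeroʳ _
  sameRows : ∀ j → rowLen (removeBox (addBox μ d) s) j ≡ rowLen (addBox (removeBox μ s) d) j
  sameRows j rewrite rowLen-removeBox (addBox μ d) s j | rowLen-addBox μ d j d≤μ
                   | rowLen-addBox (removeBox μ s) d j d≤μ∖s | rowLen-removeBox μ s j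
    with ≡ᵇ-cases j s | ≡ᵇ-cases j d
  ... | inj₁ (refl , _)  | inj₁ (refl , _) with () ← trans (sym (≡ᵇ-refl j)) (independent⇒≢ μ j j ind)
  ... | inj₁ (refl , e₁) | inj₂ (_ , e₂) rewrite e₁ | e₂ = refl
  ... | inj₂ (_ , e₁)    | inj₁ (refl , e₂) rewrite e₁ | e₂ = refl
  ... | inj₂ (_ , e₁)    | inj₂ (_ , e₂) rewrite e₁ | e₂ = refl

∑Where : ℕ → (ℕ → Bool) → (ℕ → ℕ) → ℕ
∑Where n p f = ∑< n (λ i → f i when p i)

syntax ∑Where n p (λ i → e) = ∑[ i < n ∣ p ] e

∑Outer : Diagram → (ℕ → ℕ) → ℕ
∑Outer μ = ∑Where (suc (length μ)) (isOuter μ)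

syntax ∑Outer μ (λ c → e) = ∑[ c ∈ outer μ ] e

∑Corner : Diagram → (ℕ → ℕ) → ℕ
∑Corner μ = ∑Where (length μ) (isCorner μ)

syntax ∑Corner μ (λ s → e) = ∑[ s ∈ corner μ ] e

module _ (n : ℕ) (p : ℕ → Bool) where

  ∑Where-cong : ∀ {f g} → (∀ i → p i ≡ true → f i ≡ g i) → ∑Where n p f ≡ ∑Where n p g
  ∑Where-cong {f} {g} e = ∑<-cong n pointwise
    where
    pointwise : ∀ i → i < n → f i when p i ≡ g i when p i
    pointwise i _ with p i in pi
    ... | true  = e i pi
    ... | false = refl

  ∑Where-+ : ∀ f g → ∑[ i < n ∣ p ] (f i + g i) ≡ ∑Where n p f + ∑Where n p g
  ∑Where-+ f g = trans (∑<-cong n (λ i _ → when-+ (p i) (f i) (g i))) (∑<-+ n _ _)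

  ∑Where-*ˡ : ∀ c f → ∑[ i < n ∣ p ] (c * f i) ≡ c * ∑Where n p f
  ∑Where-*ˡ c f = trans (∑<-cong n (λ i _ → when-* (p i) c (f i))) (∑<-*ˡ n c _)

  ∑Where-∧ : ∀ (q : ℕ → Bool) f → ∑Where n (λ i → p i ∧ q i) f ≡ ∑[ i < n ∣ p ] f i when q i
  ∑Where-∧ q f = ∑<-cong n {g = λ i → f i when q i when p i} (λ i _ → sym (when-∧ (p i) (q i) (f i)))

∑Where-congᵖ : ∀ n {p q} f → (∀ i → p i ≡ q i) → ∑Where n p f ≡ ∑Where n q f
∑Where-congᵖ n f e = ∑<-cong n (λ i _ → cong (f i when_) (e i))

∑Where-extend : ∀ {m n} p f → m ≤ n → (∀ i → m ≤ i → p i ≡ false) → ∑Where m p f ≡ ∑Where n p f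
∑Where-extend p f m≤n out = sym (∑<-truncate _ m≤n (λ i m≤i → cong (f i when_) (out i m≤i)))

∑Where-∨ : ∀ n p q f → (∀ i → (p i ∧ q i) ≡ false) →
  ∑Where n (λ i → p i ∨ q i) f ≡ ∑Where n p f + ∑Where n q f
∑Where-∨ n p q f disjoint = trans (∑<-cong n (λ i _ → when-∨ (p i) (q i) (f i) (disjoint i))) (∑<-+ n _ _)

∑Where-≡ᵇ : ∀ {n d} f → d < n → ∑Where n (_≡ᵇ d) f ≡ f d
∑Where-≡ᵇ {suc n} {zero}  f _         = trans (cong (f 0 +_) (∑<-zero n (λ _ → refl))) (+-identityʳ (f 0))
∑Where-≡ᵇ {suc n} {suc d} f (s≤s d<n) = ∑Where-≡ᵇ (f ∘ suc) d<n

∑Where-comm : ∀ m p n q (f : ℕ → ℕ → ℕ) →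
  ∑[ i < m ∣ p ] ∑[ j < n ∣ q ] f i j ≡ ∑[ j < n ∣ q ] ∑[ i < m ∣ p ] f i j
∑Where-comm m p n q f = begin
  ∑[ i < m ] (∑[ j < n ] f i j when q j) when p i  ≡⟨ ∑<-cong m (λ i _ → when-∑< n (p i) _) ⟩
  ∑[ i < m ] ∑[ j < n ] f i j when q j when p i    ≡⟨ ∑<-cong m (λ i _ → ∑<-cong n (λ j _ → when-comm (p i) (q j) _)) ⟩
  ∑[ i < m ] ∑[ j < n ] f i j when p i when q j    ≡⟨ ∑<-comm m n _ ⟩
  ∑[ j < n ] ∑[ i < m ] f i j when p i when q j    ≡⟨ ∑<-cong n (λ j _ → when-∑< m (q j) _) ⟨
  ∑[ j < n ] (∑[ i < m ] f i j when p i) when q j  ∎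
  where
  when-comm : ∀ a b x → x when b when a ≡ x when a when b
  when-comm true  b x = refl
  when-comm false true  x = refl
  when-comm false false x = refl

∑Outer-cong : ∀ μ {f g} → (∀ c → isOuter μ c ≡ true → f c ≡ g c) → ∑Outer μ f ≡ ∑Outer μ g
∑Outer-cong μ = ∑Where-cong (suc (length μ)) (isOuter μ)

∑Corner-cong : ∀ μ {f g} → (∀ s → isCorner μ s ≡ true → f s ≡ g s) → ∑Corner μ f ≡ ∑Corner μ g
∑Corner-cong μ = ∑Where-cong (length μ) (isCorner μ)

∑Corner-*ˡ : ∀ μ c f → ∑[ s ∈ corner μ ] (c * f s) ≡ c * ∑Corner μ f
∑Corner-*ˡ μ = ∑Where-*ˡ (length μ) (isCorner μ)

∑Outer-∑<-comm : ∀ μ n (f : ℕ → ℕ → ℕ) → ∑[ c ∈ outer μ ] ∑[ k < n ] f c k ≡ ∑[ k < n ] ∑[ c ∈ outer μ ] f c k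
∑Outer-∑<-comm μ n f =
  trans (∑<-cong (suc (length μ)) (λ c _ → when-∑< n (isOuter μ c) (f c)))
        (∑<-comm (suc (length μ)) n (λ c k → f c k when isOuter μ c))

∑Outer-when : ∀ μ b f → ∑[ c ∈ outer μ ] f c when b ≡ ∑Outer μ f when b
∑Outer-when μ true  f = refl
∑Outer-when μ false f = ∑<-zero (suc (length μ)) (λ c → if-0 (isOuter μ c))
  where
  if-0 : ∀ b → 0 when b ≡ 0
  if-0 true  = refl
  if-0 false = refl

-- Row 0 is always an outer corner, and row j + 1 is one exactly when row j ends in a corner.
∑Outer-split : ∀ μ f → ∑Outer μ f ≡ f 0 + (∑[ s ∈ corner μ ] f (suc s))
∑Outer-split μ f = refl

∑Corner-addBox : ∀ μ d → YoungShape μ → isOuter μ d ≡ true → ∀ g →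
  ∑Corner (addBox μ d) g ≡ g d + (∑[ s ∈ corner μ ] g s when independent μ d s)
∑Corner-addBox μ d young o g = begin
  ∑Where (length (addBox μ d)) (isCorner (addBox μ d)) g
    ≡⟨ ∑Where-extend (isCorner (addBox μ d)) g (length-addBox μ d d≤μ) (isCorner-beyond (addBox μ d)) ⟩
  ∑Where B (isCorner (addBox μ d)) g
    ≡⟨ ∑Where-congᵖ B g (isCorner-addBox μ d young o) ⟩
  ∑Where B (λ s → (s ≡ᵇ d) ∨ (isCorner μ s ∧ independent μ d s)) g
    ≡⟨ ∑Where-∨ B (_≡ᵇ d) _ g disjoint ⟩
  ∑Where B (_≡ᵇ d) g + ∑Where B (λ s → isCorner μ s ∧ independent μ d s) g
    ≡⟨ cong₂ _+_ (∑Where-≡ᵇ g (s≤s d≤μ)) (∑Where-∧ B (isCorner μ) (independent μ d) g) ⟩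
  g d + ∑Where B (isCorner μ) (λ s → g s when independent μ d s)
    ≡⟨ cong (g d +_) (∑Where-extend (isCorner μ) _ (n≤1+n _) (isCorner-beyond μ)) ⟨
  g d + ∑Corner μ (λ s → g s when independent μ d s) ∎
  where
  B = suc (length μ)
  d≤μ = isOuter⇒≤length μ d o
  disjoint : ∀ s → ((s ≡ᵇ d) ∧ (isCorner μ s ∧ independent μ d s)) ≡ false
  disjoint s with ≡ᵇ-cases s d
  ... | inj₁ (refl , e) rewrite e | ≡ᵇ-refl s = ∧-zeroʳ (isCorner μ s)
  ... | inj₂ (_ , e) rewrite e = refl

∑Outer-removeBox : ∀ μ s → YoungShape μ → isCorner μ s ≡ true → ∀ g →
  ∑Outer (removeBox μ s) g ≡ g s + (∑[ c ∈ outer μ ] g c when independent μ c s)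
∑Outer-removeBox μ s young corner g = begin
  ∑Where (suc (length (removeBox μ s))) (isOuter (removeBox μ s)) g
    ≡⟨ ∑Where-extend (isOuter (removeBox μ s)) g (s≤s (length-removeBox μ s)) (isOuter-beyond (removeBox μ s)) ⟩
  ∑Where B (isOuter (removeBox μ s)) g
    ≡⟨ ∑Where-congᵖ B g (isOuter-removeBox μ s young corner) ⟩
  ∑Where B (λ c → (c ≡ᵇ s) ∨ (isOuter μ c ∧ independent μ c s)) g
    ≡⟨ ∑Where-∨ B (_≡ᵇ s) _ g disjoint ⟩
  ∑Where B (_≡ᵇ s) g + ∑Where B (λ c → isOuter μ c ∧ independent μ c s) g
    ≡⟨ cong₂ _+_ (∑Where-≡ᵇ g s<B) (∑Where-∧ B (isOuter μ) (λ c → independent μ c s) g) ⟩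
  g s + ∑Outer μ (λ c → g c when independent μ c s) ∎
  where
  B = suc (length μ)
  s<B : s < B
  s<B = ≤-trans (rowLen>0⇒< μ s (isCorner⇒rowLen>0 μ s corner)) (n≤1+n _)
  disjoint : ∀ c → ((c ≡ᵇ s) ∧ (isOuter μ c ∧ independent μ c s)) ≡ false
  disjoint c with ≡ᵇ-cases c s
  ... | inj₁ (refl , e) rewrite e | ≡ᵇ-refl c = ∧-zeroʳ (isOuter μ c)
  ... | inj₂ (_ , e) rewrite e = refl

∑Corner-addBox-removeBox : ∀ μ d → YoungShape μ → isOuter μ d ≡ true → (Y : ℕ → Diagram → ℕ) →
  (∑[ s ∈ corner (addBox μ d) ] Y s (removeBox (addBox μ d) s))
  ≡ Y d μ + (∑[ s ∈ corner μ ] Y s (addBox (removeBox μ s) d) when independent μ d s)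
∑Corner-addBox-removeBox μ d young@(pos , _) o Y =
  trans (∑Corner-addBox μ d young o (λ s → Y s (removeBox (addBox μ d) s)))
        (cong₂ _+_ (cong (Y d) (removeBox-addBox μ d pos (isOuter⇒≤length μ d o)))
                   (∑Corner-cong μ (λ s corner → when-cong (cong (Y s) ∘ removeBox-addBox-comm μ d s young o corner))))

∑Outer-removeBox-addBox : ∀ μ s → YoungShape μ → isCorner μ s ≡ true → (Z : ℕ → ℕ → Diagram → ℕ) →
  (∑[ c ∈ outer (removeBox μ s) ] Z (boxRow s c) (maxRowAfter s c) (addBox (removeBox μ s) c))
  ≡ Z (suc s) (suc s) μ + (∑[ c ∈ outer μ ] Z c s (addBox (removeBox μ s) c) when independent μ c s)
∑Outer-removeBox-addBox μ s young@(pos , _) corner Z =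
  trans (∑Outer-removeBox μ s young corner (λ c → Z (boxRow s c) (maxRowAfter s c) (addBox (removeBox μ s) c)))
        (cong₂ _+_ sameRow (∑Outer-cong μ (λ c _ → when-cong (otherRow c))))
  where
  sameRow : Z (boxRow s s) (maxRowAfter s s) (addBox (removeBox μ s) s) ≡ Z (suc s) (suc s) μ
  sameRow rewrite ≡ᵇ-refl s | addBox-removeBox μ s pos corner = refl
  otherRow : ∀ c → independent μ c s ≡ true →
    Z (boxRow s c) (maxRowAfter s c) (addBox (removeBox μ s) c) ≡ Z c s (addBox (removeBox μ s) c)
  otherRow c ind rewrite independent⇒≢ μ c s ind = refl

-- The Young lattice is a differential poset, DU = UD + I, refined to keep track
-- of the rows where boxes are added and removed.
DU≡UD+I : ∀ μ → YoungShape μ → (X : ℕ → ℕ → Diagram → ℕ) →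
  (∑[ d ∈ outer μ ] ∑[ s ∈ corner (addBox μ d) ] X d s (removeBox (addBox μ d) s))
  ≡ X 0 0 μ + (∑[ s ∈ corner μ ] ∑[ c ∈ outer (removeBox μ s) ]
                 X (boxRow s c) (maxRowAfter s c) (addBox (removeBox μ s) c))
DU≡UD+I μ young X = begin
  ∑Outer μ (λ d → ∑Corner (addBox μ d) (λ s → X d s (removeBox (addBox μ d) s)))
    ≡⟨ ∑Outer-cong μ (λ d o → ∑Corner-addBox-removeBox μ d young o (X d)) ⟩
  ∑Outer μ (λ d → X d d μ + ∑Corner μ (λ s → W d s when independent μ d s))
    ≡⟨ ∑Where-+ (suc ℓ) (isOuter μ) (λ d → X d d μ) (λ d → ∑Corner μ (λ s → W d s when independent μ d s)) ⟩
  ∑Outer μ (λ d → X d d μ) + ∑Outer μ (λ d → ∑Corner μ (λ s → W d s when independent μ d s))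
    ≡⟨ cong₂ _+_ (∑Outer-split μ (λ d → X d d μ))
                 (∑Where-comm (suc ℓ) (isOuter μ) ℓ (isCorner μ) (λ d s → W d s when independent μ d s)) ⟩
  (X 0 0 μ + ∑Corner μ (λ s → X (suc s) (suc s) μ)) + ∑Corner μ (λ s → ∑Outer μ (λ c → W c s when independent μ c s))
    ≡⟨ +-assoc (X 0 0 μ) _ _ ⟩
  X 0 0 μ + (∑Corner μ (λ s → X (suc s) (suc s) μ) + ∑Corner μ (λ s → ∑Outer μ (λ c → W c s when independent μ c s)))
    ≡⟨ cong (X 0 0 μ +_) (∑Where-+ ℓ (isCorner μ) (λ s → X (suc s) (suc s) μ)
                                                  (λ s → ∑Outer μ (λ c → W c s when independent μ c s))) ⟨
  X 0 0 μ + ∑Corner μ (λ s → X (suc s) (suc s) μ + ∑Outer μ (λ c → W c s when independent μ c s))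
    ≡⟨ cong (X 0 0 μ +_) (∑Corner-cong μ (λ s corner → ∑Outer-removeBox-addBox μ s young corner X)) ⟨
  X 0 0 μ + ∑Corner μ (λ s → ∑Outer (removeBox μ s) (λ c → X (boxRow s c) (maxRowAfter s c) (addBox (removeBox μ s) c))) ∎
  where
  ℓ = length μ
  W : ℕ → ℕ → ℕ
  W d s = X d s (addBox (removeBox μ s) d)

grow : List ℕ → Diagram
grow = foldl addBox []

grow-∷ʳ : ∀ ys c → grow (ys ∷ʳ c) ≡ addBox (grow ys) c
grow-∷ʳ ys c = List.foldl-∷ʳ addBox [] c ys

outers : Diagram → List ℕ
outers μ = filterᵇ (isOuter μ) (upTo (suc (length μ)))

∑-outers : ∀ μ f → ∑ (outers μ) f ≡ ∑Outer μ f
∑-outers μ f = trans (∑-filterᵇ (isOuter μ) (upTo (suc (length μ))) f) (∑-applyUpTo id (suc (length μ)) (λ c → f c when isOuter μ c))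

paths : ℕ → List (List ℕ)
paths zero    = [] ∷ []
paths (suc n) = concatMap (λ ys → map (ys ∷ʳ_) (outers (grow ys))) (paths n)

∑-paths-suc : ∀ n f → ∑ (paths (suc n)) f ≡ ∑[ ys ∈ paths n ] ∑[ c ∈ outer (grow ys) ] f (ys ∷ʳ c)
∑-paths-suc n f = trans (∑-concatMap _ (paths n) f) (∑-cong (paths n) (λ ys →
  trans (∑-map (ys ∷ʳ_) (outers (grow ys)) f) (∑-outers (grow ys) _)))

IsPath : ℕ → List ℕ → Set
IsPath n ys = length ys ≡ n × YoungShape (grow ys)

paths-IsPath : ∀ n → All (IsPath n) (paths n)
paths-IsPath zero    = (refl , [] , λ _ → z≤n) ∷ []
paths-IsPath (suc n) = All.concat⁺ (All.map⁺ (All.map extend (paths-IsPath n)))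
  where
  extend : ∀ {ys} → IsPath n ys → All (IsPath (suc n)) (map (ys ∷ʳ_) (outers (grow ys)))
  extend {ys} (len , young) = All.map⁺ (All.map step (All.all-filter (T? ∘ isOuter (grow ys)) (upTo (suc (length (grow ys))))))
    where
    step : ∀ {c} → T (isOuter (grow ys) c) → IsPath (suc n) (ys ∷ʳ c)
    step {c} o = trans (List.length-++ ys) (trans (cong (_+ 1) len) (+-comm n 1)) ,
                 subst YoungShape (sym (grow-∷ʳ ys c)) (YoungShape-addBox (grow ys) c young (Equivalence.to T-≡ o))

withMax-∷ʳ : ∀ k ys c → k ≤ length ys → withMax k (ys ∷ʳ c) ≡ withMax k ys ∷ʳ boxRow (maxRow k ys) c
withMax-∷ʳ k ys c k≤ rewrite take-∷ʳ k ys c k≤ | drop-∷ʳ k ys c k≤ | shiftRecording-∷ʳ 0 (drop k ys) c =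
  sym (List.++-assoc (take k ys) _ _)

maxRow-∷ʳ : ∀ k ys c → k ≤ length ys → maxRow k (ys ∷ʳ c) ≡ maxRowAfter (maxRow k ys) c
maxRow-∷ʳ k ys c k≤ rewrite drop-∷ʳ k ys c k≤ = finalMaxRow-∷ʳ 0 (drop k ys) c

withMax-end : ∀ ys → withMax (length ys) ys ≡ ys ∷ʳ 0
withMax-end ys rewrite List.take-all (length ys) ys ≤-refl | List.drop-all (length ys) ys ≤-refl = refl

maxRow-end : ∀ ys → maxRow (length ys) ys ≡ 0
maxRow-end ys rewrite List.drop-all (length ys) ys ≤-refl = refl

∑-withMax-end : ∀ n (h : List ℕ → ℕ → Diagram → ℕ) →
  (∑[ ys ∈ paths n ] h (withMax n ys) (maxRow n ys) (grow ys)) ≡ (∑[ ys ∈ paths n ] h (ys ∷ʳ 0) 0 (grow ys))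
∑-withMax-end n h = ∑-congᴬ (paths-IsPath n) λ ys (len , _) →
  subst (λ k → h (withMax k ys) (maxRow k ys) (grow ys) ≡ h (ys ∷ʳ 0) 0 (grow ys)) len
        (cong₂ (λ zs s → h zs s (grow ys)) (withMax-end ys) (maxRow-end ys))

∑-withMax-∷ʳ : ∀ n (h : List ℕ → ℕ → Diagram → ℕ) →
  (∑[ ys ∈ paths (suc n) ] ∑[ k < suc n ] h (withMax k ys) (maxRow k ys) (grow ys))
  ≡ (∑[ ys ∈ paths n ] ∑[ k < suc n ] ∑[ c ∈ outer (grow ys) ]
       h (withMax k ys ∷ʳ boxRow (maxRow k ys) c) (maxRowAfter (maxRow k ys) c) (addBox (grow ys) c))
∑-withMax-∷ʳ n h = begin
  ∑[ ys ∈ paths (suc n) ] ∑< (suc n) (H ys)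
    ≡⟨ ∑-paths-suc n (λ ys → ∑< (suc n) (H ys)) ⟩
  ∑[ ys ∈ paths n ] ∑Outer (grow ys) (λ c → ∑< (suc n) (H (ys ∷ʳ c)))
    ≡⟨ ∑-congᴬ (paths-IsPath n) (λ ys (len , _) → ∑Outer-cong (grow ys) (λ c _ →
         ∑<-cong (suc n) (λ k k<1+n → extend ys c k (subst (k ≤_) (sym len) (≤-pred k<1+n))))) ⟩
  ∑[ ys ∈ paths n ] ∑Outer (grow ys) (λ c → ∑[ k < suc n ] H′ ys c k)
    ≡⟨ ∑-cong (paths n) (λ ys → ∑Outer-∑<-comm (grow ys) (suc n) (H′ ys)) ⟩
  ∑[ ys ∈ paths n ] ∑[ k < suc n ] ∑Outer (grow ys) (λ c → H′ ys c k) ∎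
  where
  H : List ℕ → ℕ → ℕ
  H ys k = h (withMax k ys) (maxRow k ys) (grow ys)
  H′ : List ℕ → ℕ → ℕ → ℕ
  H′ ys c k = h (withMax k ys ∷ʳ boxRow (maxRow k ys) c) (maxRowAfter (maxRow k ys) c) (addBox (grow ys) c)
  extend : ∀ ys c k → k ≤ length ys → H (ys ∷ʳ c) k ≡ H′ ys c k
  extend ys c k k≤ rewrite withMax-∷ʳ k ys c k≤ | maxRow-∷ʳ k ys c k≤ | grow-∷ʳ ys c = refl

-- (ys , k) ↦ (withMax k ys , maxRow k ys) is a bijection from paths of length n with
-- a time k ≤ n onto paths of length n + 1 with a marked corner, whose removal gives grow ys.
∑-withMax : ∀ n (h : List ℕ → ℕ → Diagram → ℕ) →
  (∑[ ys ∈ paths (suc n) ] ∑[ s ∈ corner (grow ys) ] h ys s (removeBox (grow ys) s))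
  ≡ (∑[ ys ∈ paths n ] ∑[ k < suc n ] h (withMax k ys) (maxRow k ys) (grow ys))
∑-withMax zero    h = refl
∑-withMax (suc n) h = begin
  ∑[ ys ∈ paths (2 + n) ] ∑Corner (grow ys) (λ s → h ys s (removeBox (grow ys) s))
    ≡⟨ ∑-paths-suc (suc n) (λ ys → ∑Corner (grow ys) (λ s → h ys s (removeBox (grow ys) s))) ⟩
  ∑[ ys ∈ paths (1 + n) ] ∑Outer (grow ys) (λ d →
    ∑Corner (grow (ys ∷ʳ d)) (λ s → h (ys ∷ʳ d) s (removeBox (grow (ys ∷ʳ d)) s)))
    ≡⟨ ∑-congᴬ (paths-IsPath (1 + n)) (λ ys (_ , young) → trans
         (∑Outer-cong (grow ys) (λ d _ → cong (λ μ → ∑Corner μ (λ s → h (ys ∷ʳ d) s (removeBox μ s))) (grow-∷ʳ ys d)))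
         (DU≡UD+I (grow ys) young (λ d → h (ys ∷ʳ d)))) ⟩
  ∑[ ys ∈ paths (1 + n) ] (h (ys ∷ʳ 0) 0 (grow ys) + ∑Corner (grow ys) (λ s → h′ ys s (removeBox (grow ys) s)))
    ≡⟨ ∑-+ (paths (1 + n)) (λ ys → h (ys ∷ʳ 0) 0 (grow ys))
                           (λ ys → ∑Corner (grow ys) (λ s → h′ ys s (removeBox (grow ys) s))) ⟩
  (∑[ ys ∈ paths (1 + n) ] h (ys ∷ʳ 0) 0 (grow ys))
    + (∑[ ys ∈ paths (1 + n) ] ∑Corner (grow ys) (λ s → h′ ys s (removeBox (grow ys) s)))
    ≡⟨ cong₂ _+_ (sym (∑-withMax-end (1 + n) h)) (trans (∑-withMax n h′) (sym (∑-withMax-∷ʳ n h))) ⟩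
  (∑[ ys ∈ paths (1 + n) ] H ys (suc n)) + (∑[ ys ∈ paths (1 + n) ] ∑< (suc n) (H ys))
    ≡⟨ +-comm (∑ (paths (1 + n)) (λ ys → H ys (suc n))) (∑ (paths (1 + n)) (λ ys → ∑< (suc n) (H ys))) ⟩
  (∑[ ys ∈ paths (1 + n) ] ∑< (suc n) (H ys)) + (∑[ ys ∈ paths (1 + n) ] H ys (suc n))
    ≡⟨ ∑-+ (paths (1 + n)) (λ ys → ∑< (suc n) (H ys)) (λ ys → H ys (suc n)) ⟨
  ∑[ ys ∈ paths (1 + n) ] (∑< (suc n) (H ys) + H ys (suc n))
    ≡⟨ ∑-cong (paths (1 + n)) (λ ys → ∑<-suc (suc n) (H ys)) ⟨
  ∑[ ys ∈ paths (1 + n) ] ∑< (2 + n) (H ys) ∎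
  where
  H : List ℕ → ℕ → ℕ
  H ys k = h (withMax k ys) (maxRow k ys) (grow ys)
  h′ : List ℕ → ℕ → Diagram → ℕ
  h′ ys s κ = ∑Outer κ (λ c → h (ys ∷ʳ boxRow s c) (maxRowAfter s c) (addBox κ c))

-- Permutations counted by their recording tableau

recordingOf : List ℕ → List ℕ
recordingOf w = recording [] (map fin w)

insertAt : ℕ → List ℕ → ℕ → List ℕ
insertAt k w a = take k w ++ a ∷ drop k w

∑-insertEverywhere : ∀ a w g → ∑ (insertEverywhere a w) g ≡ ∑[ k < suc (length w) ] g (insertAt k w a)
∑-insertEverywhere a []      g = refl
∑-insertEverywhere a (b ∷ l) g =
  cong (g (a ∷ b ∷ l) +_) (trans (∑-map (b ∷_) (insertEverywhere a l) g) (∑-insertEverywhere a l (g ∘ (b ∷_))))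

insertEverywhere-All : ∀ (P : ℕ → Set) {a} w → P a → All P w →
  All (λ v → length v ≡ suc (length w) × All P v) (insertEverywhere a w)
insertEverywhere-All P []      pa []        = (refl , pa ∷ []) ∷ []
insertEverywhere-All P (b ∷ l) pa (pb ∷ pl) =
  (refl , pa ∷ pb ∷ pl) ∷ All.map⁺ (All.map (λ (len , pv) → cong suc len , pb ∷ pv) (insertEverywhere-All P l pa pl))

IsPerm : ℕ → List ℕ → Set
IsPerm n w = length w ≡ n × All (_< n) w

perms-IsPerm : ∀ n → All (IsPerm n) (perms n)
perms-IsPerm zero    = (refl , []) ∷ []
perms-IsPerm (suc n) = All.concat⁺ (All.map⁺ (All.map extend (perms-IsPerm n)))
  where
  extend : ∀ {w} → IsPerm n w → All (IsPerm (suc n)) (insertEverywhere n w)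
  extend {w} (len , w<n) = All.map (λ (len′ , pv) → trans len′ (cong suc len) , pv)
    (insertEverywhere-All (_< suc n) w ≤-refl (All.map (λ x<n → ≤-trans x<n (n≤1+n n)) w<n))

recordingOf-insertAt : ∀ n w k → All (_< n) w → k ≤ length w → recordingOf (insertAt k w n) ≡ withMax k (recordingOf w)
recordingOf-insertAt n w k w<n k≤ = begin
  recording [] (map fin (take k w ++ n ∷ drop k w))
    ≡⟨ cong (recording []) (List.map-++ fin (take k w) (n ∷ drop k w)) ⟩
  recording [] (map fin (take k w) ++ fin n ∷ map fin (drop k w))
    ≡⟨ proj₂ (proj₂ (insertMaxAt (map fin (take k w)) (map fin (drop k w))
                                 (below (take k w) (All.take⁺ k w<n)) (below (drop k w) (All.drop⁺ k w<n)))) ⟩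
  withMax (length (map fin (take k w))) (recording [] (map fin (take k w) ++ map fin (drop k w)))
    ≡⟨ cong₂ withMax length-prefix (cong (recording [])
         (trans (sym (List.map-++ fin (take k w) (drop k w))) (cong (map fin) (List.take++drop≡id k w)))) ⟩
  withMax k (recordingOf w) ∎
  where
  open MaxLetter (fin n)
  below : ∀ v → All (_< n) v → All Below (map fin v)
  below v v<n = All.map⁺ (All.map (λ {a} a<n → <⇒<ᵇ-true a<n , ≤⇒≮ᵇ (≤-trans (n≤1+n a) a<n)) v<n)
  length-prefix : length (map fin (take k w)) ≡ k
  length-prefix = trans (List.length-map fin (take k w)) (trans (List.length-take k w) (m≤n⇒m⊓n≡m k≤))

-- The number of standard Young tableaux of shape μ, when n is the size of μ.
dim : ℕ → Diagram → ℕ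
dim zero    μ = 1
dim (suc n) μ = ∑[ s ∈ corner μ ] dim n (removeBox μ s)

∑-perms : ∀ n (g : List ℕ → ℕ) → ∑[ w ∈ perms n ] g (recordingOf w) ≡ ∑[ ys ∈ paths n ] g ys * dim n (grow ys)
∑-perms zero    g = cong (_+ 0) (sym (*-identityʳ (g [])))
∑-perms (suc n) g = begin
  ∑[ w ∈ perms (suc n) ] g (recordingOf w)
    ≡⟨ ∑-concatMap (insertEverywhere n) (perms n) (g ∘ recordingOf) ⟩
  ∑[ w ∈ perms n ] ∑[ v ∈ insertEverywhere n w ] g (recordingOf v)
    ≡⟨ ∑-congᴬ (perms-IsPerm n) insertMax ⟩
  ∑[ w ∈ perms n ] ∑[ k < suc n ] g (withMax k (recordingOf w))
    ≡⟨ ∑-perms n (λ ys → ∑[ k < suc n ] g (withMax k ys)) ⟩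
  ∑[ ys ∈ paths n ] (∑[ k < suc n ] g (withMax k ys)) * dim n (grow ys)
    ≡⟨ ∑-cong (paths n) (λ ys → trans (*-comm _ (dim n (grow ys)))
                                      (sym (∑<-*ˡ (suc n) (dim n (grow ys)) (λ k → g (withMax k ys))))) ⟩
  ∑[ ys ∈ paths n ] ∑[ k < suc n ] dim n (grow ys) * g (withMax k ys)
    ≡⟨ ∑-withMax n (λ ys _ κ → dim n κ * g ys) ⟨
  ∑[ ys ∈ paths (suc n) ] ∑[ s ∈ corner (grow ys) ] dim n (removeBox (grow ys) s) * g ys
    ≡⟨ ∑-cong (paths (suc n)) (λ ys → trans (∑Corner-cong (grow ys) (λ s _ → *-comm (dim n (removeBox (grow ys) s)) (g ys)))
                                               (∑Corner-*ˡ (grow ys) (g ys) (λ s → dim n (removeBox (grow ys) s)))) ⟩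
  ∑[ ys ∈ paths (suc n) ] g ys * dim (suc n) (grow ys) ∎
  where
  insertMax : ∀ w → IsPerm n w → ∑[ v ∈ insertEverywhere n w ] g (recordingOf v) ≡ ∑[ k < suc n ] g (withMax k (recordingOf w))
  insertMax w (len , w<n) rewrite ∑-insertEverywhere n w (g ∘ recordingOf) | len =
    ∑<-cong (suc n) (λ k k<1+n → cong g (recordingOf-insertAt n w k w<n (subst (k ≤_) (sym len) (≤-pred k<1+n))))

-- The augmented process read off the recording word

module _ where
  open MaxLetter ∞

  Below-isInf : ∀ x → Below x → isInf x ≡ false
  Below-isInf (fin a) _ = refl

  findInRow-finite : ∀ r → All Below r → findInRow r ≡ nothing
  findInRow-finite []      []       = refl
  findInRow-finite (a ∷ r) (p ∷ ps) rewrite Below-isInf a p | findInRow-finite r ps = refl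

  findInRow-∷ʳ∞ : ∀ r → All Below r → findInRow (r ∷ʳ ∞) ≡ just (length r)
  findInRow-∷ʳ∞ []      []       = refl
  findInRow-∷ʳ∞ (a ∷ r) (p ∷ ps) rewrite Below-isInf a p | findInRow-∷ʳ∞ r ps = refl

  findInf-withMaxAt : ∀ T y → All (All Below) T → y ≤ length T → findInf (withMaxAt T y) ≡ just (rowLen (shape T) y , y)
  findInf-withMaxAt []       zero    _        _        = refl
  findInf-withMaxAt (r ∷ rs) zero    (p ∷ _)  _        rewrite findInRow-∷ʳ∞ r p = refl
  findInf-withMaxAt (r ∷ rs) (suc y) (p ∷ ps) (s≤s y≤) rewrite findInRow-finite r p | findInf-withMaxAt rs y ps y≤ = refl

  removeInf-finite : ∀ r → All Below r → removeInf r ≡ r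
  removeInf-finite []      []       = refl
  removeInf-finite (a ∷ r) (p ∷ ps) rewrite Below-isInf a p | removeInf-finite r ps = refl

  removeInf-∷ʳ∞ : ∀ r → All Below r → removeInf (r ∷ʳ ∞) ≡ r
  removeInf-∷ʳ∞ []      []       = refl
  removeInf-∷ʳ∞ (a ∷ r) (p ∷ ps) rewrite Below-isInf a p | removeInf-∷ʳ∞ r ps = refl

  map-length-removeInf : ∀ T → All (All Below) T → map (length ∘ removeInf) T ≡ shape T
  map-length-removeInf []       []       = refl
  map-length-removeInf (r ∷ rs) (p ∷ ps) = cong₂ _∷_ (cong length (removeInf-finite r p)) (map-length-removeInf rs ps)

  nonzero? : (n : ℕ) → Dec (n ≢ 0)
  nonzero? n = ¬? (n ≟ 0)

  regularShape-withMaxAt : ∀ T y → All (All Below) T → NonemptyRows T → y ≤ length T →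
    filter nonzero? (map (length ∘ removeInf) (withMaxAt T y)) ≡ shape T
  regularShape-withMaxAt []       y       _        _        _ = refl
  regularShape-withMaxAt (r ∷ rs) zero    (p ∷ ps) ne       _
    rewrite removeInf-∷ʳ∞ r p | map-length-removeInf rs ps
    = List.filter-all nonzero? (All.map⁺ (All.map (λ 0<n n≡0 → <⇒≢ 0<n (sym n≡0)) ne))
  regularShape-withMaxAt (r ∷ rs) (suc y) (p ∷ ps) (q ∷ qs) (s≤s y≤)
    rewrite removeInf-finite r p =
    trans (List.filter-accept nonzero? (λ n≡0 → <⇒≢ q (sym n≡0))) (cong (length r ∷_) (regularShape-withMaxAt rs y ps qs y≤))

  shapeStar-withMaxAt : ∀ T y → All (All Below) T → NonemptyRows T → y ≤ length T →
    shapeStar (withMaxAt T y) ≡ (shape T , (rowLen (shape T) y , y))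
  shapeStar-withMaxAt T y pT ne y≤ with findInf (withMaxAt T y) | findInf-withMaxAt T y pT y≤
  ... | just _ | refl = cong (_, (rowLen (shape T) y , y)) (regularShape-withMaxAt T y pT ne y≤)

  finite-Below : ∀ v → All Below (map fin v)
  finite-Below []      = []
  finite-Below (_ ∷ v) = (refl , refl) ∷ finite-Below v

augmented : ℕ → List ℕ → Aug
augmented m ys = grow ys , (rowLen (grow ys) (maxRow m ys) , maxRow m ys)

RSK≡grow : ∀ w → RSK w ≡ grow (recordingOf w)
RSK≡grow w = trans (cong shape (Ptab≡foldl (map fin w))) (shape-foldl [] (map fin w))

recordingOf-take : ∀ k w → recordingOf (take k w) ≡ take k (recordingOf w)
recordingOf-take k w = trans (cong (recording []) (sym (List.take-map k w))) (recording-take [] k (map fin w))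

augAt≡augmented : ∀ m k w → m ≤ k → m ≤ length w → augAt m k w ≡ augmented m (recordingOf (take k w))
augAt≡augmented m k w m≤k m≤w = begin
  shapeStar (Ptab (u ++ ∞ ∷ v))
    ≡⟨ cong shapeStar (trans (Ptab≡foldl (u ++ ∞ ∷ v)) (proj₁ inserted)) ⟩
  shapeStar (withMaxAt tab y)
    ≡⟨ shapeStar-withMaxAt tab y (foldl-insertT-All Below (u ++ v) (subst (All Below) (sym u++v) (finite-Below (take k w))) [])
                                 (foldl-insertT-NonemptyRows [] (u ++ v) []) (proj₁ (proj₂ inserted)) ⟩
  (shape tab , (rowLen (shape tab) y , y))
    ≡⟨ cong (λ μ → μ , (rowLen μ y , y)) (shape-foldl [] (u ++ v)) ⟩
  augmented (length u) (recording [] (u ++ v))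
    ≡⟨ cong₂ augmented length-u (cong (recording []) u++v) ⟩
  augmented m (recordingOf (take k w)) ∎
  where
  open MaxLetter ∞
  u = map fin (take m w)
  v = map fin (drop m (take k w))
  tab = foldl insertT [] (u ++ v)
  y = maxRow (length u) (recording [] (u ++ v))
  inserted = insertMaxAt u v (finite-Below (take m w)) (finite-Below (drop m (take k w)))
  u++v : u ++ v ≡ map fin (take k w)
  u++v = begin
    map fin (take m w) ++ map fin (drop m (take k w))
      ≡⟨ cong (λ x → map fin x ++ v) (trans (cong (λ j → take j w) (sym (m≤n⇒m⊓n≡m m≤k))) (sym (List.take-take m k w))) ⟩
    map fin (take m (take k w)) ++ map fin (drop m (take k w))  ≡⟨ sym (List.map-++ fin (take m (take k w)) _) ⟩
    map fin (take m (take k w) ++ drop m (take k w))  ≡⟨ cong (map fin) (List.take++drop≡id m (take k w)) ⟩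
    map fin (take k w) ∎
  length-u : length u ≡ m
  length-u = trans (List.length-map fin (take m w)) (trans (List.length-take m w) (m≤n⇒m⊓n≡m m≤w))

augmentedPath : ℕ → ℕ → List ℕ → List Aug
augmentedPath m t ys = map (λ i → augmented m (take (m + i) ys)) (upTo (suc (t ∸ m)))

pathOf≡augmentedPath : ∀ m t w → m ≤ t → t ≤ length w → pathOf m t (take t w) ≡ augmentedPath m t (take t (recordingOf w))
pathOf≡augmentedPath m t w m≤t t≤w = List.map-cong atTime (upTo (suc (t ∸ m)))
  where
  m≤t⊓w : m ≤ length (take t w)
  m≤t⊓w = subst (m ≤_) (sym (trans (List.length-take t w) (m≤n⇒m⊓n≡m t≤w))) m≤t
  atTime : ∀ i → augAt m (m + i) (take t w) ≡ augmented m (take (m + i) (take t (recordingOf w)))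
  atTime i = trans (augAt≡augmented m (m + i) (take t w) (m≤m+n m i) m≤t⊓w)
                   (cong (augmented m) (trans (recordingOf-take (m + i) (take t w)) (cong (take (m + i)) (recordingOf-take t w))))

augmentedPath-last : ∀ {m t π Λ} ys → m ≤ t → length ys ≡ t → augmentedPath m t ys ≡ π ∷ʳ Λ → augmented m ys ≡ Λ
augmentedPath-last {m} {t} {π} {Λ} ys m≤t len path≡ = begin
  augmented m ys
    ≡⟨ cong (augmented m) (List.take-all (m + (t ∸ m)) ys (≤-reflexive (trans len (sym (m+[n∸m]≡n m≤t))))) ⟨
  augmented m (take (m + (t ∸ m)) ys)
    ≡⟨ List.∷ʳ-injectiveʳ (map f (upTo (t ∸ m))) π (trans mapSnoc path≡) ⟩
  Λ ∎
  where
  f : ℕ → Aug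
  f i = augmented m (take (m + i) ys)
  mapSnoc : map f (upTo (t ∸ m)) ∷ʳ f (t ∸ m) ≡ map f (upTo (suc (t ∸ m)))
  mapSnoc = trans (sym (List.map-++ f (upTo (t ∸ m)) (t ∸ m ∷ []))) (cong (map f) (List.upTo-∷ʳ (t ∸ m)))

augmented-∷ʳ : ∀ m ys c → m ≤ length ys →
  augmented m (ys ∷ʳ c) ≡ (addBox (grow ys) c , (rowLen (addBox (grow ys) c) (maxRowAfter (maxRow m ys) c) , maxRowAfter (maxRow m ys) c))
augmented-∷ʳ m ys c m≤ rewrite grow-∷ʳ ys c | maxRow-∷ʳ m ys c m≤ = refl

OuterCorner⇒ : ∀ μ {x y} → OuterCorner μ (x , y) → x ≡ rowLen μ y × y ≤ length μ
OuterCorner⇒ μ {y = zero}  x≡        = sym x≡ , z≤n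
OuterCorner⇒ μ {y = suc j} (x≡ , x<) = sym x≡ , rowLen>0⇒< μ j (≤-trans (s≤s z≤n) x<)

isOuter⇒OuterCorner : ∀ μ c → isOuter μ c ≡ true → OuterCorner μ (rowLen μ c , c)
isOuter⇒OuterCorner μ zero    _ = refl
isOuter⇒OuterCorner μ (suc j) o = refl , <ᵇ-true⇒< _ _ o

addBox-injective : ∀ μ {c d} → c ≤ length μ → d ≤ length μ → addBox μ c ≡ addBox μ d → c ≡ d
addBox-injective μ {c} {d} c≤ d≤ eq with ≡ᵇ-cases d c
... | inj₁ (d≡c , _) = sym d≡c
... | inj₂ (d≢c , _) = ⊥-elim (1+n≢n (begin
  suc (rowLen μ c)       ≡⟨ cong grown (≡ᵇ-refl c) ⟨
  grown (c ≡ᵇ c)         ≡⟨ rowLen-addBox μ c c c≤ ⟨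
  rowLen (addBox μ c) c  ≡⟨ cong (λ ν → rowLen ν c) eq ⟩
  rowLen (addBox μ d) c  ≡⟨ rowLen-addBox μ d c d≤ ⟩
  grown (c ≡ᵇ d)         ≡⟨ cong grown (≢⇒≡ᵇ-false (d≢c ∘ sym)) ⟩
  rowLen μ c             ∎))
  where
  grown : Bool → ℕ
  grown b = if b then suc (rowLen μ c) else rowLen μ c

↗*-step : ∀ μ y c → isOuter μ c ≡ true →
  (μ , (rowLen μ y , y)) ↗* (addBox μ c , (rowLen (addBox μ c) (maxRowAfter y c) , maxRowAfter y c))
↗*-step μ y c o = (rowLen μ c , c) , isOuter⇒OuterCorner μ c o , refl , hit , miss
  where
  μ′ = addBox μ c
  hit : (rowLen μ c , c) ≡ (rowLen μ y , y) → (rowLen μ′ (maxRowAfter y c) , maxRowAfter y c) ≡ (rowLen μ′ (suc y) , suc y)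
  hit refl rewrite ≡ᵇ-refl c = refl
  miss : (rowLen μ c , c) ≢ (rowLen μ y , y) → (rowLen μ′ (maxRowAfter y c) , maxRowAfter y c) ≡ (rowLen μ y , y)
  miss c≢y with ≡ᵇ-cases c y
  ... | inj₁ (refl , _) = ⊥-elim (c≢y refl)
  ... | inj₂ (c≢y , e) rewrite e | rowLen-addBox μ c y (isOuter⇒≤length μ c o) | ≢⇒≡ᵇ-false (c≢y ∘ sym) = refl

↗*-deterministic : ∀ {Λ Λ₁ Λ₂} → Λ ↗* Λ₁ → Λ ↗* Λ₂ → proj₁ Λ₁ ≡ proj₁ Λ₂ → Λ₁ ≡ Λ₂
↗*-deterministic {κ , □} {μ , □₁} {_ , □₂}
                 (b₁ , oc₁ , μ≡₁ , hit₁ , miss₁) (b₂ , oc₂ , μ≡₂ , hit₂ , miss₂) refl =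
  cong (μ ,_) same□
  where
  sameBox : b₁ ≡ b₂
  sameBox with OuterCorner⇒ κ oc₁ | OuterCorner⇒ κ oc₂
  ... | (refl , y₁≤) | (refl , y₂≤) = cong (λ y → rowLen κ y , y) (addBox-injective κ y₁≤ y₂≤ (trans (sym μ≡₁) μ≡₂))
  same□ : □₁ ≡ □₂
  same□ with b₁ ≟B □
  ... | yes b₁≡□ = trans (hit₁ b₁≡□) (sym (hit₂ (trans (sym sameBox) b₁≡□)))
  ... | no b₁≢□  = trans (miss₁ b₁≢□) (sym (miss₂ (b₁≢□ ∘ trans sameBox)))

count≡∑ : ∀ {P : Pred (List ℕ) 0ℓ} (P? : Decidable P) xs → count P? xs ≡ ∑[ x ∈ xs ] 1 when does (P? x)
count≡∑ P? []       = refl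
count≡∑ P? (x ∷ xs) with does (P? x)
... | true  = cong suc (count≡∑ P? xs)
... | false = count≡∑ P? xs

count-perms : ∀ t {P : Pred (List ℕ) 0ℓ} (P? : Decidable P) (b : List ℕ → Bool) →
  (∀ w → IsPerm (suc t) w → does (P? w) ≡ b (recordingOf w)) →
  count P? (perms (suc t)) ≡ ∑[ zs ∈ paths t ] ∑[ c ∈ outer (grow zs) ] dim (suc t) (addBox (grow zs) c) when b (zs ∷ʳ c)
count-perms t P? b P≡b = begin
  count P? (perms (suc t))
    ≡⟨ count≡∑ P? (perms (suc t)) ⟩
  ∑[ w ∈ perms (suc t) ] 1 when does (P? w)
    ≡⟨ ∑-congᴬ (perms-IsPerm (suc t)) (λ w perm → cong (1 when_) (P≡b w perm)) ⟩
  ∑[ w ∈ perms (suc t) ] 1 when b (recordingOf w)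
    ≡⟨ ∑-perms (suc t) (λ ys → 1 when b ys) ⟩
  ∑[ ys ∈ paths (suc t) ] 1 when b ys * dim (suc t) (grow ys)
    ≡⟨ ∑-paths-suc t (λ ys → 1 when b ys * dim (suc t) (grow ys)) ⟩
  ∑[ zs ∈ paths t ] ∑[ c ∈ outer (grow zs) ] 1 when b (zs ∷ʳ c) * dim (suc t) (grow (zs ∷ʳ c))
    ≡⟨ ∑-cong (paths t) (λ zs → ∑Outer-cong (grow zs) (λ c _ →
         trans (1-when-* (b (zs ∷ʳ c)) _) (cong (λ μ → dim (suc t) μ when b (zs ∷ʳ c)) (grow-∷ʳ zs c)))) ⟩
  ∑[ zs ∈ paths t ] ∑[ c ∈ outer (grow zs) ] dim (suc t) (addBox (grow zs) c) when b (zs ∷ʳ c) ∎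

-- The Markov property: once the condition p on the past pins down the current
-- shape κ, the weight of the possible next boxes depends on κ only.
count-factor : ∀ t {P : Pred (List ℕ) 0ℓ} (P? : Decidable P) (b p : List ℕ → Bool) (q : Diagram → Bool) κ →
  (∀ w → IsPerm (suc t) w → does (P? w) ≡ b (recordingOf w)) →
  (∀ zs c → IsPath t zs → isOuter (grow zs) c ≡ true → b (zs ∷ʳ c) ≡ (p zs ∧ q (addBox (grow zs) c))) →
  (∀ zs → IsPath t zs → p zs ≡ true → grow zs ≡ κ) →
  count P? (perms (suc t))
  ≡ (∑[ zs ∈ paths t ] 1 when p zs) * (∑[ c ∈ outer κ ] dim (suc t) (addBox κ c) when q (addBox κ c))
count-factor t P? b p q κ P≡b b≡pq p⇒κ = begin
  count P? (perms (suc t))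
    ≡⟨ count-perms t P? b P≡b ⟩
  ∑[ zs ∈ paths t ] ∑[ c ∈ outer (grow zs) ] dim (suc t) (addBox (grow zs) c) when b (zs ∷ʳ c)
    ≡⟨ ∑-congᴬ (paths-IsPath t) (λ zs path → ∑Outer-cong (grow zs) (λ c o →
         trans (cong (dim (suc t) (addBox (grow zs) c) when_) (b≡pq zs c path o))
               (sym (when-∧ (p zs) (q (addBox (grow zs) c)) (dim (suc t) (addBox (grow zs) c)))))) ⟩
  ∑[ zs ∈ paths t ] ∑[ c ∈ outer (grow zs) ] dim (suc t) (addBox (grow zs) c) when q (addBox (grow zs) c) when p zs
    ≡⟨ ∑-cong (paths t) (λ zs → ∑Outer-when (grow zs) (p zs) (λ c → dim (suc t) (addBox (grow zs) c) when q (addBox (grow zs) c))) ⟩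
  ∑[ zs ∈ paths t ] next (grow zs) when p zs
    ≡⟨ ∑-when-factor {P = IsPath t} p (next ∘ grow) (next κ) (paths-IsPath t) (λ zs path pzs → cong next (p⇒κ zs path pzs)) ⟩
  (∑[ zs ∈ paths t ] 1 when p zs) * next κ ∎
  where
  next : Diagram → ℕ
  next μ = ∑[ c ∈ outer μ ] dim (suc t) (addBox μ c) when q (addBox μ c)

*-exchange : ∀ a b c d → (a * b) * (c * d) ≡ (a * d) * (c * b)
*-exchange = solve-∀
  where open import Data.Nat.Tactic.RingSolver using (solve-∀)

module Transition (m t : ℕ) (m≤t : m ≤ t) (π : List Aug) (Λ Λ̃ : Aug) where

  isPast : List ℕ → Bool
  isPast zs = does (augmentedPath m t zs ≟AL (π ∷ʳ Λ))

  isRegular : List ℕ → Bool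
  isRegular zs = does (grow zs ≟D proj₁ Λ)

  isTarget : Diagram → Bool
  isTarget μ = does (μ ≟D proj₁ Λ̃)

  isJoint : List ℕ → Bool
  isJoint ys = isPast (take t ys) ∧ does (augmented m ys ≟A Λ̃)

  #past : ℕ
  #past = ∑[ zs ∈ paths t ] 1 when isPast zs

  #regular : ℕ
  #regular = ∑[ zs ∈ paths t ] 1 when isRegular zs

  #next : (Diagram → Bool) → ℕ
  #next q = ∑[ c ∈ outer (proj₁ Λ) ] dim (suc t) (addBox (proj₁ Λ) c) when q (addBox (proj₁ Λ) c)

  take-∷ʳ-IsPath : ∀ zs c → IsPath t zs → take t (zs ∷ʳ c) ≡ zs
  take-∷ʳ-IsPath zs c (len , _) = trans (take-∷ʳ t zs c (≤-reflexive (sym len))) (List.take-all t zs (≤-reflexive len))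

  isPast⇒augmented : ∀ zs → IsPath t zs → isPast zs ≡ true → augmented m zs ≡ Λ
  isPast⇒augmented zs (len , _) past = augmentedPath-last zs m≤t len (does⇒ (augmentedPath m t zs ≟AL (π ∷ʳ Λ)) past)

  isPast⇒shape : ∀ zs → IsPath t zs → isPast zs ≡ true → grow zs ≡ proj₁ Λ
  isPast⇒shape zs path past = cong proj₁ (isPast⇒augmented zs path past)

  isRegular⇒shape : ∀ zs → IsPath t zs → isRegular zs ≡ true → grow zs ≡ proj₁ Λ
  isRegular⇒shape zs _ = does⇒ (grow zs ≟D proj₁ Λ)

  isPast⇒↗* : ∀ zs c → IsPath t zs → isOuter (grow zs) c ≡ true → isPast zs ≡ true → Λ ↗* augmented m (zs ∷ʳ c)
  isPast⇒↗* zs c path@(len , _) o past =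
    subst₂ _↗*_ (isPast⇒augmented zs path past) (sym (augmented-∷ʳ m zs c (subst (m ≤_) (sym len) m≤t)))
                (↗*-step (grow zs) (maxRow m zs) c o)

  isJoint-↗* : Λ ↗* Λ̃ → ∀ zs c → IsPath t zs → isOuter (grow zs) c ≡ true →
    isJoint (zs ∷ʳ c) ≡ (isPast zs ∧ isTarget (addBox (grow zs) c))
  isJoint-↗* E zs c path o rewrite take-∷ʳ-IsPath zs c path with isPast zs in past
  ... | false = refl
  ... | true  = does-⇔ (mk⇔ (λ eq → trans (sym (grow-∷ʳ zs c)) (cong proj₁ eq))
                            (λ eq → ↗*-deterministic (isPast⇒↗* zs c path o past) E (trans (grow-∷ʳ zs c) eq)))
                       (augmented m (zs ∷ʳ c) ≟A Λ̃) (addBox (grow zs) c ≟D proj₁ Λ̃)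

  isJoint-¬↗* : ¬ (Λ ↗* Λ̃) → ∀ zs c → IsPath t zs → isOuter (grow zs) c ≡ true →
    isJoint (zs ∷ʳ c) ≡ (isPast zs ∧ false)
  isJoint-¬↗* ¬E zs c path o rewrite take-∷ʳ-IsPath zs c path with isPast zs in past
  ... | false = refl
  ... | true  = dec-false (augmented m (zs ∷ʳ c) ≟A Λ̃) (λ eq → ¬E (subst (Λ ↗*_) eq (isPast⇒↗* zs c path o past)))

  past≡ : ∀ w → IsPerm (suc t) w → does (pathOf m t (take t w) ≟AL (π ∷ʳ Λ)) ≡ isPast (take t (recordingOf w))
  past≡ w (len , _) = cong (λ P → does (P ≟AL (π ∷ʳ Λ))) (pathOf≡augmentedPath m t w m≤t (subst (t ≤_) (sym len) (n≤1+n t)))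

  regular≡ : ∀ w → does (RSK (take t w) ≟D proj₁ Λ) ≡ isRegular (take t (recordingOf w))
  regular≡ w = cong (λ μ → does (μ ≟D proj₁ Λ)) (trans (RSK≡grow (take t w)) (cong grow (recordingOf-take t w)))

  joint≡ : ∀ w → IsPerm (suc t) w →
    does ((pathOf m t (take t w) ≟AL (π ∷ʳ Λ)) ×-dec (augAt m (suc t) w ≟A Λ̃)) ≡ isJoint (recordingOf w)
  joint≡ w perm@(len , _) = cong₂ _∧_ (past≡ w perm) (cong (λ A → does (A ≟A Λ̃))
    (trans (augAt≡augmented m (suc t) w m≤1+t (subst (m ≤_) (sym len) m≤1+t))
           (cong (augmented m ∘ recordingOf) (List.take-all (suc t) w (≤-reflexive len)))))
    where
    m≤1+t = ≤-trans m≤t (n≤1+n t)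

  count-past : count (λ w → pathOf m t (take t w) ≟AL (π ∷ʳ Λ)) (perms (suc t)) ≡ #past * #next (const true)
  count-past = count-factor t _ (isPast ∘ take t) isPast (const true) (proj₁ Λ) past≡
    (λ zs c path _ → trans (cong isPast (take-∷ʳ-IsPath zs c path)) (sym (∧-identityʳ _))) isPast⇒shape

  count-regular : count (λ w → RSK (take t w) ≟D proj₁ Λ) (perms (suc t)) ≡ #regular * #next (const true)
  count-regular = count-factor t _ (isRegular ∘ take t) isRegular (const true) (proj₁ Λ) (λ w _ → regular≡ w)
    (λ zs c path _ → trans (cong isRegular (take-∷ʳ-IsPath zs c path)) (sym (∧-identityʳ _))) isRegular⇒shape

  count-regularJoint : count (λ w → (RSK (take t w) ≟D proj₁ Λ) ×-dec (RSK w ≟D proj₁ Λ̃)) (perms (suc t))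
                       ≡ #regular * #next isTarget
  count-regularJoint = count-factor t _ (λ ys → isRegular (take t ys) ∧ isTarget (grow ys)) isRegular isTarget (proj₁ Λ)
    (λ w _ → cong₂ _∧_ (regular≡ w) (cong isTarget (RSK≡grow w)))
    (λ zs c path _ → cong₂ _∧_ (cong isRegular (take-∷ʳ-IsPath zs c path)) (cong isTarget (grow-∷ʳ zs c))) isRegular⇒shape

  count-joint : Λ ↗* Λ̃ →
    count (λ w → (pathOf m t (take t w) ≟AL (π ∷ʳ Λ)) ×-dec (augAt m (suc t) w ≟A Λ̃)) (perms (suc t)) ≡ #past * #next isTarget
  count-joint E = count-factor t _ isJoint isPast isTarget (proj₁ Λ) joint≡ (isJoint-↗* E) isPast⇒shape

  count-joint-¬↗* : ¬ (Λ ↗* Λ̃) →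
    count (λ w → (pathOf m t (take t w) ≟AL (π ∷ʳ Λ)) ×-dec (augAt m (suc t) w ≟A Λ̃)) (perms (suc t)) ≡ 0
  count-joint-¬↗* ¬E = begin
    count _ (perms (suc t))      ≡⟨ count-factor t _ isJoint isPast (const false) (proj₁ Λ) joint≡ (isJoint-¬↗* ¬E) isPast⇒shape ⟩
    #past * #next (const false)  ≡⟨ cong (#past *_) (∑Outer-when (proj₁ Λ) false (λ c → dim (suc t) (addBox (proj₁ Λ) c))) ⟩
    #past * 0                    ≡⟨ *-zeroʳ #past ⟩
    0                            ∎

theorem3p5 : (m t : ℕ) → m ≤ t → (π : List Aug) (Λ Λ̃ : Aug) → IsAug Λ → IsAug Λ̃ →
    let past = λ (w : List ℕ) → pathOf m t (take t w) ≟AL (π ∷ʳ Λ)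
        joint = λ (w : List ℕ) → past w ×-dec (augAt m (suc t) w ≟A Λ̃)
        reg = λ (w : List ℕ) → RSK (take t w) ≟D proj₁ Λ
        regJoint = λ (w : List ℕ) → reg w ×-dec (RSK w ≟D proj₁ Λ̃)
        N = perms (suc t)
    in (Λ ↗* Λ̃ → count joint N * count reg N ≡ count past N * count regJoint N)
       × (¬ (Λ ↗* Λ̃) → count joint N ≡ 0)
theorem3p5 m t m≤t π Λ Λ̃ _ _ =
  (λ E → trans (cong₂ _*_ (count-joint E) count-regular)
         (trans (*-exchange #past (#next isTarget) #regular (#next (const true)))
                (sym (cong₂ _*_ count-past count-regularJoint))))
  , count-joint-¬↗*
  where open Transition m t m≤t π Λ Λ̃
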